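{- Let $n\ge3$ and let $\Gamma$ be the digraph of order $n^2$ whose adjacency matrix, written as an $n\times n$ array of $n\times n$ blocks, is $$A=\begin{bmatrix}0 & I_n & \cdots & I_n\\ J_n-I_n & 0 & \cdots & 0\\ \vdots & \vdots & & \vdots\\ J_n-I_n & 0&\cdots&0\end{bmatrix},$$ i.e. the block in position $(1,c)$ is $I_n$ for $c=2,\dots,n$, the block in position $(r,1)$ is $J_n-I_n$ for $r=2,\dots,n$, and all other blocks are zero. Then $\Gamma$ is a restricted-normal digraph that is not a directed join.
   Context: $I_n$ is the $n\times n$ identity and $J_n$ the $n\times n$ all-ones matrix. The Laplacian of a digraph is $L=D-A$ with $D$ the diagonal matrix of out-degrees. $\mathbf{e}$ is the all-ones vector; a restrictor matrix of order $N$ is an $N\times(N-1)$ matrix $Q$ with orthonormal columns orthogonal to $\mathbf{e}$. A digraph is restricted-normal if $L$ is not normal but $Q^*LQ$ is normal (independent of the choice of $Q$). A digraph $(V,E)$ is a directed join if there is a partition $V=V_1\sqcup V_2$ into nonempty sets such that $(i,j)\in E$ for all $i\in V_1,j\in V_2$ and there is no edge $(j,i)\in E$ with $j\in V_2,i\in V_1$. -}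

module Defs where

open import Level using (0ℓ)
open import Data.Nat as ℕ using (ℕ; zero; suc)
open import Data.Fin using (Fin; zero; suc; _≟_)
open import Data.Bool using (Bool; true; false; not; _∧_; if_then_else_)
open import Data.Product using (_×_; _,_; Σ; ∃)
open import Data.Integer as ℤ using (ℤ; +_; -[1+_])
open import Relation.Nullary using (¬_)
open import Relation.Nullary.Decidable using (⌊_⌋)
open import Relation.Binary.PropositionalEquality using (_≡_)
open import Algebra.Bundles using (CommutativeRing)

-- Vertices of the digraph Γ of order n² : pairs (block index r, index i
-- inside the block), both in Fin n.  Block index zero is block "1".

Vertex : ℕ → Set
Vertex n = Fin n × Fin n

isZero : ∀ {n} → Fin n → Bool
isZero zero    = true
isZero (suc _) = false

eqFin : ∀ {n} → Fin n → Fin n → Bool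
eqFin i j = ⌊ i ≟ j ⌋

adjΓ : (n : ℕ) → Vertex n → Vertex n → Bool
adjΓ n (r , i) (s , j) =
  if isZero r then (not (isZero s) ∧ eqFin i j)
  else (isZero s ∧ not (eqFin i j))

sumℕ : ∀ {n} → (Fin n → ℕ) → ℕ
sumℕ {zero}  f = 0
sumℕ {suc n} f = f zero ℕ.+ sumℕ (λ i → f (suc i))

sumℤ : ∀ {n} → (Fin n → ℤ) → ℤ
sumℤ {zero}  f = + 0
sumℤ {suc n} f = f zero ℤ.+ sumℤ (λ i → f (suc i))

sumVℤ : ∀ {n} → (Vertex n → ℤ) → ℤ
sumVℤ f = sumℤ (λ r → sumℤ (λ i → f (r , i)))

b2n : Bool → ℕ
b2n true  = 1
b2n false = 0

outdeg : ∀ {n} → (Vertex n → Vertex n → Bool) → Vertex n → ℕ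
outdeg adj u = sumℕ (λ s → sumℕ (λ j → b2n (adj u (s , j))))

eqV : ∀ {n} → Vertex n → Vertex n → Bool
eqV (r , i) (s , j) = eqFin r s ∧ eqFin i j

laplacian : ∀ {n} → (Vertex n → Vertex n → Bool) → Vertex n → Vertex n → ℤ
laplacian adj u v =
  (if eqV u v then + outdeg adj u else + 0) ℤ.- + b2n (adj u v)

IsNormalℤ : ∀ {n} → (Vertex n → Vertex n → ℤ) → Set
IsNormalℤ M = ∀ u v →
  sumVℤ (λ w → M u w ℤ.* M v w) ≡ sumVℤ (λ w → M w u ℤ.* M w v)

-- Commutative rings with an involution (conjugation); this covers ℂ
-- with complex conjugation and ℝ with the identity.

record InvolutiveCommRing : Set₁ where
  field
    commRing : CommutativeRing 0ℓ 0ℓ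
  open CommutativeRing commRing public
  field
    conj       : Carrier → Carrier
    conj-cong  : ∀ {x y} → x ≈ y → conj x ≈ conj y
    conj-+     : ∀ x y → conj (x + y) ≈ conj x + conj y
    conj-*     : ∀ x y → conj (x * y) ≈ conj x * conj y
    conj-1     : conj 1# ≈ 1#
    conj-invol : ∀ x → conj (conj x) ≈ x

module _ (K : InvolutiveCommRing) where
  open InvolutiveCommRing K using (Carrier; _≈_; _+_; _*_; -_; 0#; 1#; conj)

  sumK : ∀ {n} → (Fin n → Carrier) → Carrier
  sumK {zero}  f = 0#
  sumK {suc n} f = f zero + sumK (λ i → f (suc i))

  sumVK : ∀ {n} → (Vertex n → Carrier) → Carrier
  sumVK f = sumK (λ r → sumK (λ i → f (r , i)))

  ℕ→K : ℕ → Carrier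
  ℕ→K zero    = 0#
  ℕ→K (suc m) = 1# + ℕ→K m

  ℤ→K : ℤ → Carrier
  ℤ→K (+ m)      = ℕ→K m
  ℤ→K -[1+ m ]   = - ℕ→K (suc m)

  IsRestrictor : (n : ℕ) → (Vertex n → Fin (n ℕ.* n ℕ.∸ 1) → Carrier) → Set
  IsRestrictor n Q =
    (∀ k l → sumVK (λ w → conj (Q w k) * Q w l)
               ≈ (if eqFin k l then 1# else 0#))
    × (∀ k → sumVK (λ w → conj (Q w k)) ≈ 0#)

  restrictL : (n : ℕ) → (Vertex n → Fin (n ℕ.* n ℕ.∸ 1) → Carrier)
            → (Vertex n → Vertex n → ℤ)
            → Fin (n ℕ.* n ℕ.∸ 1) → Fin (n ℕ.* n ℕ.∸ 1) → Carrier
  restrictL n Q L k l =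
    sumVK (λ u → sumVK (λ v → conj (Q u k) * (ℤ→K (L u v) * Q v l)))

  IsNormalK : ∀ {m} → (Fin m → Fin m → Carrier) → Set
  IsNormalK M = ∀ k l →
    sumK (λ t → M k t * conj (M l t)) ≈ sumK (λ t → conj (M t k) * M t l)

IsRestrictedNormal : (n : ℕ) → (Vertex n → Vertex n → Bool) → Set₁
IsRestrictedNormal n adj =
  ¬ IsNormalℤ (laplacian adj)
  × ((K : InvolutiveCommRing) →
       let open InvolutiveCommRing K in
       (Σ Carrier λ x → ℕ→K K (n ℕ.* n) * x ≈ 1#) →
       (Q : Vertex n → Fin (n ℕ.* n ℕ.∸ 1) → Carrier) →
       IsRestrictor K n Q →
       IsNormalK K (restrictL K n Q (laplacian adj)))

IsDirectedJoin : (n : ℕ) → (Vertex n → Vertex n → Bool) → Set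
IsDirectedJoin n adj =
  Σ (Vertex n → Bool) λ S →
    (∃ λ v → S v ≡ true) × (∃ λ w → S w ≡ false)
    × (∀ i j → S i ≡ true → S j ≡ false → adj i j ≡ true)
    × (∀ j i → S j ≡ false → S i ≡ true → adj j i ≡ false)

-- Write N = n², x = 1/N and L = m I - A with m = n - 1, the common out-degree in Γ.
-- A restrictor Q satisfies Q Qᴴ = I - x J: the square matrix [e | Q] has the left inverse
-- [x eᵀ ; Qᴴ], and over a commutative ring a one-sided inverse of a square matrix is
-- two-sided (by the adjugate and the multiplicativity of the determinant). As L e = 0, the
-- entries of (QᴴLQ)(QᴴLQ)ᴴ and of (QᴴLQ)ᴴ(QᴴLQ) are bilinear forms, in columns of Q (which
-- sum to 0), against L Lᵀ and against Lᵀ L - x c cᵀ, where c holds the column sums of L.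
-- For Γ the matrix L Lᵀ + x c cᵀ - Lᵀ L has the shape g u + h u', and every form of this
-- shape vanishes on vectors summing to 0; hence QᴴLQ is normal. L itself is not normal:
-- at ((1 , 1) , (1 , 2)) the entries of L Lᵀ and Lᵀ L are 0 and (n - 1)(n - 2). Finally,
-- every edge of Γ lies in an I block or a J - I block, and next to each such edge there
-- is a non-edge that a directed join would have to contain.

module Submission where

open import Defs
open import Level using (0ℓ)
open import Algebra.Bundles using (CommutativeRing)
import Data.Nat.Properties as ℕₚ
open import Data.Nat as ℕ using (ℕ; zero; suc; _≤_; s≤s; z≤n)
open import Data.Integer as ℤ using (ℤ; +_; -[1+_]; _⊖_)
import Data.Integer.Properties as ℤ
open import Data.Sign as Sign using (Sign)
import Data.Maybe
open import Relation.Nullary.Decidable using (dec⇒maybe)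
open import Data.Product using (Σ; _×_; _,_; proj₁; proj₂; Σ-syntax)
open import Relation.Nullary using (¬_; yes; no)
open import Relation.Binary.PropositionalEquality as ≡ using (_≡_; _≢_)
open import Data.Fin using (Fin; zero; suc; punchIn; inject₁; toℕ; _↑ˡ_; _↑ʳ_; combine; remQuot)
open import Data.Fin.Properties using (suc-injective; _≟_; punchInᵢ≢i; toℕ-inject₁; remQuot-combine)
open import Data.Bool using (true; false; if_then_else_; not)
open import Data.Vec.Functional using (updateAt; insertAt)
open import Data.Vec.Functional.Properties using (updateAt-updates; updateAt-minimal; updateAt-id-local)
open import Data.List using (List; []; _∷_; allFin)
open import Data.List.Relation.Unary.Any using (here; there)
open import Data.List.Membership.Propositional using (_∈_)
open import Data.List.Membership.Propositional.Properties using (∈-allFin)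
open import Data.Empty using (⊥; ⊥-elim)
open import Function using (const)

module IntegerCoefficients (R : CommutativeRing 0ℓ 0ℓ) where

  open CommutativeRing R
  open import Algebra.Properties.Ring ring using (-‿involutive; -0#≈0#; -‿+-comm; -1*x≈-x)
  open import Algebra.Properties.Semiring.Mult.TCOptimised semiring using (1+×; ×-homo-+; ×1-homo-*) renaming (_×_ to _×ₙ_)
  open import Algebra.Solver.Ring.AlmostCommutativeRing using (fromCommutativeRing; _-Raw-AlmostCommutative⟶_)
  open import Relation.Binary.Reasoning.Setoid setoid
  open import Algebra.Properties.CommutativeSemigroup +-commutativeSemigroup using () renaming (interchange to +-interchange)
  open import Algebra.Properties.CommutativeSemigroup *-commutativeSemigroup using () renaming (interchange to *-interchange)

  -- The optimised multiple, for which fromℕ 1 is 1# itself: the solver's constants then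
  -- evaluate to the expected terms.
  fromℕ : ℕ → Carrier
  fromℕ n = n ×ₙ 1#

  fromℕ-suc : ∀ n → fromℕ (suc n) ≈ 1# + fromℕ n
  fromℕ-suc n = 1+× n 1#

  fromℕ-+ : ∀ m n → fromℕ (m ℕ.+ n) ≈ fromℕ m + fromℕ n
  fromℕ-+ = ×-homo-+ 1#

  fromℕ-* : ∀ m n → fromℕ (m ℕ.* n) ≈ fromℕ m * fromℕ n
  fromℕ-* = ×1-homo-*

  fromℤ : ℤ → Carrier
  fromℤ (+ n)    = fromℕ n
  fromℤ -[1+ n ] = - fromℕ (suc n)

  fromℤ-⊖ : ∀ m n → fromℤ (m ⊖ n) ≈ fromℕ m - fromℕ n
  fromℤ-⊖ zero    zero    = sym (trans (+-congˡ -0#≈0#) (+-identityʳ 0#))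
  fromℤ-⊖ zero    (suc n) = sym (+-identityˡ _)
  fromℤ-⊖ (suc m) zero    = sym (trans (+-congˡ -0#≈0#) (+-identityʳ _))
  fromℤ-⊖ (suc m) (suc n) = begin
    fromℤ (suc m ⊖ suc n)                 ≡⟨ ≡.cong fromℤ (ℤ.[1+m]⊖[1+n]≡m⊖n m n) ⟩
    fromℤ (m ⊖ n)                         ≈⟨ fromℤ-⊖ m n ⟩
    fromℕ m - fromℕ n                     ≈⟨ +-identityˡ _ ⟨
    0# + (fromℕ m - fromℕ n)              ≈⟨ +-congʳ (-‿inverseʳ 1#) ⟨
    (1# - 1#) + (fromℕ m - fromℕ n)       ≈⟨ +-interchange 1# (- 1#) _ _ ⟩
    (1# + fromℕ m) + (- 1# - fromℕ n)     ≈⟨ +-congˡ (-‿+-comm 1# _) ⟩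
    (1# + fromℕ m) - (1# + fromℕ n)       ≈⟨ +-cong (fromℕ-suc m) (-‿cong (fromℕ-suc n)) ⟨
    fromℕ (suc m) - fromℕ (suc n)         ∎

  fromℤ-+ : ∀ i j → fromℤ (i ℤ.+ j) ≈ fromℤ i + fromℤ j
  fromℤ-+ (+ m)    (+ n)    = ×-homo-+ 1# m n
  fromℤ-+ (+ m)    -[1+ n ] = fromℤ-⊖ m (suc n)
  fromℤ-+ -[1+ m ] (+ n)    = trans (fromℤ-⊖ n (suc m)) (+-comm _ _)
  fromℤ-+ -[1+ m ] -[1+ n ] = begin
    - fromℕ (suc (suc (m ℕ.+ n)))          ≡⟨ ≡.cong (λ k → - fromℕ (suc k)) (ℕₚ.+-suc m n) ⟨
    - fromℕ (suc m ℕ.+ suc n)              ≈⟨ -‿cong (×-homo-+ 1# (suc m) (suc n)) ⟩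
    - (fromℕ (suc m) + fromℕ (suc n))      ≈⟨ -‿+-comm _ _ ⟨
    - fromℕ (suc m) - fromℕ (suc n)        ∎

  fromℤ-neg : ∀ i → fromℤ (ℤ.- i) ≈ - fromℤ i
  fromℤ-neg (+ zero)  = sym -0#≈0#
  fromℤ-neg (+ suc n) = refl
  fromℤ-neg -[1+ n ]  = sym (-‿involutive _)

  private
    fromSign : Sign → Carrier
    fromSign Sign.+ = 1#
    fromSign Sign.- = - 1#

    fromSign-* : ∀ s t → fromSign (s Sign.* t) ≈ fromSign s * fromSign t
    fromSign-* Sign.+ Sign.+ = sym (*-identityˡ _)
    fromSign-* Sign.+ Sign.- = sym (*-identityˡ _)
    fromSign-* Sign.- Sign.+ = sym (*-identityʳ _)
    fromSign-* Sign.- Sign.- = sym (trans (-1*x≈-x (- 1#)) (-‿involutive 1#))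

    fromℤ-◃ : ∀ s n → fromℤ (s ℤ.◃ n) ≈ fromSign s * fromℕ n
    fromℤ-◃ s      zero    = sym (zeroʳ _)
    fromℤ-◃ Sign.+ (suc n) = sym (*-identityˡ _)
    fromℤ-◃ Sign.- (suc n) = sym (-1*x≈-x _)

    fromℤ-signAbs : ∀ i → fromℤ i ≈ fromSign (ℤ.sign i) * fromℕ ℤ.∣ i ∣
    fromℤ-signAbs (+ n)    = sym (*-identityˡ _)
    fromℤ-signAbs -[1+ n ] = sym (-1*x≈-x _)

  fromℤ-* : ∀ i j → fromℤ (i ℤ.* j) ≈ fromℤ i * fromℤ j
  fromℤ-* i j = begin
    fromℤ (i ℤ.* j)
      ≈⟨ fromℤ-◃ (ℤ.sign i Sign.* ℤ.sign j) (ℤ.∣ i ∣ ℕ.* ℤ.∣ j ∣) ⟩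
    fromSign (ℤ.sign i Sign.* ℤ.sign j) * fromℕ (ℤ.∣ i ∣ ℕ.* ℤ.∣ j ∣)
      ≈⟨ *-cong (fromSign-* (ℤ.sign i) (ℤ.sign j)) (×1-homo-* ℤ.∣ i ∣ ℤ.∣ j ∣) ⟩
    (fromSign (ℤ.sign i) * fromSign (ℤ.sign j)) * (fromℕ ℤ.∣ i ∣ * fromℕ ℤ.∣ j ∣)
      ≈⟨ *-interchange _ _ _ _ ⟩
    (fromSign (ℤ.sign i) * fromℕ ℤ.∣ i ∣) * (fromSign (ℤ.sign j) * fromℕ ℤ.∣ j ∣)
      ≈⟨ *-cong (fromℤ-signAbs i) (fromℤ-signAbs j) ⟨
    fromℤ i * fromℤ j ∎

  fromℤ-morphism : ℤ.+-*-rawRing -Raw-AlmostCommutative⟶ fromCommutativeRing R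
  fromℤ-morphism = record
    { ⟦_⟧    = fromℤ
    ; +-homo = fromℤ-+
    ; *-homo = fromℤ-*
    ; -‿homo = fromℤ-neg
    ; 0-homo = refl
    ; 1-homo = refl
    }

  open import Algebra.Solver.Ring ℤ.+-*-rawRing (fromCommutativeRing R) fromℤ-morphism
    (λ i j → Data.Maybe.map (λ i≡j → reflexive (≡.cong fromℤ i≡j)) (dec⇒maybe (i ℤ.≟ j)))
    public using (solve; _:=_; _:+_; _:*_; _:-_; :-_; con; Polynomial)

module Sums (R : CommutativeRing 0ℓ 0ℓ) where

  open CommutativeRing R hiding (zero)
  open IntegerCoefficients R
  open import Algebra.Properties.Ring ring using (-0#≈0#; -‿+-comm)
  import Algebra.Properties.Semiring.Sum semiring as Sum
  open import Relation.Binary.Reasoning.Setoid setoid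

  -- Opaque, so that unification treats a sum as rigid instead of unfolding it.
  opaque
    ∑ : ∀ {m} → (Fin m → Carrier) → Carrier
    ∑ = Sum.sum

    ∑-zero : (f : Fin 0 → Carrier) → ∑ f ≡ 0#
    ∑-zero f = ≡.refl

    ∑-suc : ∀ {m} (f : Fin (suc m) → Carrier) → ∑ f ≡ f zero + ∑ (λ i → f (suc i))
    ∑-suc f = ≡.refl

    ∑-cong : ∀ {m} {f g : Fin m → Carrier} → (∀ i → f i ≈ g i) → ∑ f ≈ ∑ g
    ∑-cong = Sum.sum-cong-≋

    ∑-distrib-+ : ∀ {m} (f g : Fin m → Carrier) → ∑ (λ i → f i + g i) ≈ ∑ f + ∑ g
    ∑-distrib-+ = Sum.∑-distrib-+

    ∑-comm : ∀ {m p} (f : Fin m → Fin p → Carrier) → ∑ (λ i → ∑ (λ j → f i j)) ≈ ∑ (λ j → ∑ (λ i → f i j))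
    ∑-comm = Sum.∑-comm

    *-distribˡ-∑ : ∀ {m} (a : Carrier) (f : Fin m → Carrier) → a * ∑ f ≈ ∑ (λ i → a * f i)
    *-distribˡ-∑ = Sum.*-distribˡ-sum

    *-distribʳ-∑ : ∀ {m} (a : Carrier) (f : Fin m → Carrier) → ∑ f * a ≈ ∑ (λ i → f i * a)
    *-distribʳ-∑ = Sum.*-distribʳ-sum

    ∑-≈0 : ∀ {m} (f : Fin m → Carrier) → (∀ i → f i ≈ 0#) → ∑ f ≈ 0#
    ∑-≈0 {m} f f≈0 = trans (Sum.sum-cong-≋ f≈0) (Sum.sum-replicate-zero m)

  -‿distrib-∑ : ∀ {m} (f : Fin m → Carrier) → - ∑ f ≈ ∑ (λ i → - f i)
  -‿distrib-∑ {zero}  f = trans (-‿cong (reflexive (∑-zero f))) (trans -0#≈0# (sym (reflexive (∑-zero _))))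
  -‿distrib-∑ {suc m} f = begin
    - ∑ f                                    ≡⟨ ≡.cong -_ (∑-suc f) ⟩
    - (f zero + ∑ (λ i → f (suc i)))         ≈⟨ -‿+-comm _ _ ⟨
    - f zero + - ∑ (λ i → f (suc i))         ≈⟨ +-congˡ (-‿distrib-∑ (λ i → f (suc i))) ⟩
    - f zero + ∑ (λ i → - f (suc i))         ≡⟨ ∑-suc _ ⟨
    ∑ (λ i → - f i)                          ∎

  ∑-const : ∀ {m} (c : Carrier) → ∑ {m} (λ _ → c) ≈ fromℕ m * c
  ∑-const {zero}  c = trans (reflexive (∑-zero _)) (sym (zeroˡ c))
  ∑-const {suc m} c = begin
    ∑ {suc m} (λ _ → c)       ≡⟨ ∑-suc _ ⟩
    c + ∑ {m} (λ _ → c)       ≈⟨ +-cong (sym (*-identityˡ c)) (∑-const c) ⟩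
    1# * c + fromℕ m * c      ≈⟨ distribʳ c 1# (fromℕ m) ⟨
    (1# + fromℕ m) * c        ≈⟨ *-congʳ (fromℕ-suc m) ⟨
    fromℕ (suc m) * c         ∎



  ∑-split : ∀ a {b} (F : Fin (a ℕ.+ b) → Carrier) →
    ∑ F ≈ ∑ (λ i → F (i ↑ˡ b)) + ∑ (λ j → F (a ↑ʳ j))
  ∑-split zero F = sym (trans (+-congʳ (reflexive (∑-zero _))) (+-identityˡ _))
  ∑-split (suc a) F = begin
    ∑ F   ≡⟨ ∑-suc F ⟩
    F zero + ∑ (λ i → F (suc i))  ≈⟨ +-congˡ (∑-split a (λ i → F (suc i))) ⟩
    F zero + (∑ (λ i → F (suc (i ↑ˡ _))) + ∑ (λ j → F (suc (a ↑ʳ j))))  ≈⟨ sym (+-assoc _ _ _) ⟩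
    (F zero + ∑ (λ i → F (suc (i ↑ˡ _)))) + ∑ (λ j → F (suc (a ↑ʳ j)))
       ≈⟨ +-congʳ (sym (reflexive (∑-suc _))) ⟩
    ∑ (λ i → F (i ↑ˡ _)) + ∑ (λ j → F (suc a ↑ʳ j)) ∎

  ∑-combine : ∀ m k (F : Fin (m ℕ.* k) → Carrier) →
    ∑ F ≈ ∑ (λ i → ∑ (λ j → F (combine {m} {k} i j)))
  ∑-combine zero k F = trans (reflexive (∑-zero F)) (sym (reflexive (∑-zero _)))
  ∑-combine (suc m) k F = begin
    ∑ F  ≈⟨ ∑-split k F ⟩
    ∑ (λ j → F (j ↑ˡ (m ℕ.* k))) + ∑ (λ y → F (k ↑ʳ y))
       ≈⟨ +-congˡ (∑-combine m k (λ y → F (k ↑ʳ y))) ⟩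
    ∑ (λ j → F (combine {suc m} {k} zero j)) + ∑ (λ i → ∑ (λ j → F (combine {suc m} {k} (suc i) j)))
       ≈⟨ sym (reflexive (∑-suc _)) ⟩
    ∑ (λ i → ∑ (λ j → F (combine {suc m} {k} i j))) ∎

  δ : ∀ {m} → Fin m → Fin m → Carrier
  δ zero    zero    = 1#
  δ zero    (suc j) = 0#
  δ (suc i) zero    = 0#
  δ (suc i) (suc j) = δ i j

  ∑-*δ : ∀ {m} (f : Fin m → Carrier) (k : Fin m) → ∑ (λ j → f j * δ j k) ≈ f k
  ∑-*δ {suc m} f zero = trans (reflexive (∑-suc _)) (trans (+-cong (*-identityʳ _) (∑-≈0 (λ j → f (suc j) * 0#) (λ i → zeroʳ _))) (+-identityʳ _))
  ∑-*δ {suc m} f (suc k) = trans (reflexive (∑-suc _)) (trans (+-cong (zeroʳ _) (∑-*δ (λ j → f (suc j)) k)) (+-identityˡ _))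

  ∑-δ* : ∀ {m} (f : Fin m → Carrier) (k : Fin m) → ∑ (λ j → δ k j * f j) ≈ f k
  ∑-δ* {suc m} f zero = trans (reflexive (∑-suc _)) (trans (+-cong (*-identityˡ _) (∑-≈0 (λ j → 0# * f (suc j)) (λ i → zeroˡ _))) (+-identityʳ _))
  ∑-δ* {suc m} f (suc k) = trans (reflexive (∑-suc _)) (trans (+-cong (zeroˡ _) (∑-δ* (λ j → f (suc j)) k)) (+-identityˡ _))

  δ-sym : ∀ {m} (i j : Fin m) → δ i j ≡ δ j i
  δ-sym zero zero = ≡.refl
  δ-sym zero (suc j) = ≡.refl
  δ-sym (suc i) zero = ≡.refl
  δ-sym (suc i) (suc j) = δ-sym i j

  δ-refl : ∀ {m} (i : Fin m) → δ i i ≈ 1#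
  δ-refl zero = refl
  δ-refl (suc i) = δ-refl i

  δ-≢ : ∀ {m} (i j : Fin m) → i ≢ j → δ i j ≈ 0#
  δ-≢ zero zero ne = ⊥-elim (ne ≡.refl)
  δ-≢ zero (suc j) ne = refl
  δ-≢ (suc i) zero ne = refl
  δ-≢ (suc i) (suc j) ne = δ-≢ i j (λ e → ne (≡.cong suc e))

module Determinant (R : CommutativeRing 0ℓ 0ℓ) where

  open CommutativeRing R hiding (zero)
  open IntegerCoefficients R
  open Sums R public
  open import Algebra.Properties.Ring ring using (-‿distribˡ-*; -‿involutive; -0#≈0#; x+x≈x⇒x≈0)
  open import Algebra.Properties.Group +-group using (inverseʳ-unique)
  open import Relation.Binary.Reasoning.Setoid setoid

  replaceAt : ∀ {m} {A : Set} → (Fin m → A) → Fin m → A → Fin m → A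
  replaceAt xs i x = updateAt xs i (const x)

  replaceAt-updates : ∀ {m} {A : Set} (xs : Fin m → A) i x → replaceAt xs i x i ≡ x
  replaceAt-updates xs i x = updateAt-updates i xs

  replaceAt-minimal : ∀ {m} {A : Set} (xs : Fin m → A) i x j → j ≢ i → replaceAt xs i x j ≡ xs j
  replaceAt-minimal xs i x j j≢i = updateAt-minimal j i xs j≢i

  replaceAt-precompose : ∀ {m p q} (F : Fin m → Fin p → Carrier) i v (g : Fin q → Fin p) r k →
    replaceAt F i v r (g k) ≡ replaceAt (λ r k → F r (g k)) i (λ k → v (g k)) r k
  replaceAt-precompose F zero v g zero k = ≡.refl
  replaceAt-precompose F zero v g (suc r) k = ≡.refl
  replaceAt-precompose F (suc i) v g zero k = ≡.refl
  replaceAt-precompose F (suc i) v g (suc r) k = replaceAt-precompose (λ r → F (suc r)) i v g r k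

  replaceAt-cong : ∀ {m p} (F G : Fin m → Fin p → Carrier) i v w →
    (∀ r k → F r k ≈ G r k) → (∀ k → v k ≈ w k) → ∀ r k → replaceAt F i v r k ≈ replaceAt G i w r k
  replaceAt-cong F G zero v w e1 e2 zero k = e2 k
  replaceAt-cong F G zero v w e1 e2 (suc r) k = e1 (suc r) k
  replaceAt-cong F G (suc i) v w e1 e2 zero k = e1 zero k
  replaceAt-cong F G (suc i) v w e1 e2 (suc r) k =
    replaceAt-cong (λ r → F (suc r)) (λ r → G (suc r)) i v w (λ r → e1 (suc r)) e2 r k

  sgn : ∀ {m} → Fin m → Carrier
  sgn zero    = 1#
  sgn (suc i) = - sgn i

  swapIndex : ∀ {p} → Fin (suc p) → Fin p → Fin p
  swapIndex {suc p} zero    k = zero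
  swapIndex (suc j) zero    = j
  swapIndex (suc j) (suc k) = suc (swapIndex j k)

  punchIn-swapIndex : ∀ {p} (j : Fin (suc p)) (k : Fin p) → punchIn (punchIn j k) (swapIndex j k) ≡ j
  punchIn-swapIndex zero zero = ≡.refl
  punchIn-swapIndex zero (suc k) = ≡.refl
  punchIn-swapIndex (suc j) zero = ≡.refl
  punchIn-swapIndex (suc j) (suc k) = ≡.cong suc (punchIn-swapIndex j k)

  punchIn²-swapIndex : ∀ {p} (j : Fin (suc (suc p))) (k : Fin (suc p)) (l : Fin p) →
    punchIn (punchIn j k) (punchIn (swapIndex j k) l) ≡ punchIn j (punchIn k l)
  punchIn²-swapIndex zero zero l = ≡.refl
  punchIn²-swapIndex zero (suc k) l = ≡.refl
  punchIn²-swapIndex (suc j) zero l = ≡.refl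
  punchIn²-swapIndex (suc j) (suc k) zero = ≡.refl
  punchIn²-swapIndex (suc j) (suc k) (suc l) = ≡.cong suc (punchIn²-swapIndex j k l)

  sgn-swapIndex : ∀ {p} (j : Fin (suc p)) (k : Fin p) →
    sgn (punchIn j k) * sgn (swapIndex j k) ≈ - (sgn j * sgn k)
  sgn-swapIndex zero zero = solve 1 (λ u → ((:- u) :* u) := (:- (u :* u))) refl 1#
  sgn-swapIndex zero (suc k) = solve 2 (λ u x → ((:- (:- x)) :* u) := (:- (u :* (:- x)))) refl 1# (sgn k)
  sgn-swapIndex (suc j) zero = solve 2 (λ u x → (u :* x) := (:- ((:- x) :* u))) refl 1# (sgn j)
  sgn-swapIndex (suc j) (suc k) = begin
    (- sgn (punchIn j k)) * (- sgn (swapIndex j k))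
      ≈⟨ solve 2 (λ x y → ((:- x) :* (:- y)) := (x :* y)) refl (sgn (punchIn j k)) (sgn (swapIndex j k)) ⟩
    sgn (punchIn j k) * sgn (swapIndex j k)  ≈⟨ sgn-swapIndex j k ⟩
    - (sgn j * sgn k)
      ≈⟨ solve 2 (λ x y → (:- (x :* y)) := (:- ((:- x) :* (:- y)))) refl (sgn j) (sgn k) ⟩
    - ((- sgn j) * (- sgn k)) ∎

  antisymmetric-∑≈0 : ∀ {p} (H : Fin (suc p) → Fin p → Carrier) →
    (∀ j k → H j k + H (punchIn j k) (swapIndex j k) ≈ 0#) →
    ∑ (λ j → ∑ (λ k → H j k)) ≈ 0#
  antisymmetric-∑≈0 {zero} H e = ∑-≈0 _ (λ j → reflexive (∑-zero _))
  antisymmetric-∑≈0 {suc p} H e = begin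
    ∑ (λ j → ∑ (λ k → H j k))
      ≡⟨ ∑-suc _ ⟩
    ∑ (λ k → H zero k) + ∑ (λ j → ∑ (λ k → H (suc j) k))
      ≈⟨ +-congˡ (∑-cong (λ j → reflexive (∑-suc _))) ⟩
    (∑ (λ k → H zero k) + ∑ (λ j → H (suc j) zero + ∑ (λ k → H (suc j) (suc k))))
      ≈⟨ +-congˡ (∑-distrib-+ (λ j → H (suc j) zero) (λ j → ∑ (λ k → H (suc j) (suc k)))) ⟩
    (∑ (λ k → H zero k) + (∑ (λ j → H (suc j) zero) + ∑ (λ j → ∑ (λ k → H (suc j) (suc k)))))
      ≈⟨ sym (+-assoc _ _ _) ⟩
    ((∑ (λ k → H zero k) + ∑ (λ j → H (suc j) zero)) + ∑ (λ j → ∑ (λ k → H (suc j) (suc k))))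
      ≈⟨ +-cong (trans (sym (∑-distrib-+ (λ k → H zero k) (λ j → H (suc j) zero)))
                       (∑-≈0 (λ k → H zero k + H (suc k) zero) (λ k → e zero k)))
                (antisymmetric-∑≈0 (λ j k → H (suc j) (suc k)) (λ j k → e (suc j) (suc k))) ⟩
    0# + 0#  ≈⟨ +-identityˡ _ ⟩
    0# ∎

  Matrix : ℕ → Set
  Matrix m = Fin m → Fin m → Carrier

  minor : ∀ {m} → Matrix (suc m) → Fin (suc m) → Matrix m
  minor A j i k = A (suc i) (punchIn j k)

  det : ∀ {m} → Matrix m → Carrier
  det {zero}  A = 1#
  det {suc m} A = ∑ (λ j → sgn j * (A zero j * det (minor A j)))

  det-cong : ∀ {m} (A B : Matrix m) → (∀ i k → A i k ≈ B i k) → det A ≈ det B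
  det-cong {zero} A B e = refl
  det-cong {suc m} A B e = ∑-cong (λ j → *-congˡ (*-cong (e zero j)
    (det-cong (minor A j) (minor B j) (λ i k → e (suc i) (punchIn j k)))))

  det-rowLinear : ∀ {m} (A B C : Matrix m) (i : Fin m) (a : Carrier) →
    (∀ k → A i k ≈ a * B i k + C i k) →
    (∀ r → r ≢ i → ∀ k → A r k ≈ B r k) →
    (∀ r → r ≢ i → ∀ k → A r k ≈ C r k) →
    det A ≈ a * det B + det C
  det-rowLinear {suc m} A B C zero a ei eB eC = begin
    ∑ (λ j → sgn j * (A zero j * det (minor A j)))
      ≈⟨ ∑-cong (λ j → *-congˡ (*-cong (ei j) (refl {det (minor A j)}))) ⟩
    ∑ (λ j → sgn j * ((a * B zero j + C zero j) * det (minor A j)))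
      ≈⟨ ∑-cong (λ j → l (sgn j) a (B zero j) (C zero j) (det (minor A j))) ⟩
    ∑ (λ j → a * (sgn j * (B zero j * det (minor A j))) + sgn j * (C zero j * det (minor A j)))
      ≈⟨ ∑-distrib-+ (λ j → a * (sgn j * (B zero j * det (minor A j)))) (λ j → sgn j * (C zero j * det (minor A j))) ⟩
    ∑ (λ j → a * (sgn j * (B zero j * det (minor A j)))) + ∑ (λ j → sgn j * (C zero j * det (minor A j)))
      ≈⟨ +-cong (sym (*-distribˡ-∑ a (λ j → sgn j * (B zero j * det (minor A j))))) refl ⟩
    a * ∑ (λ j → sgn j * (B zero j * det (minor A j))) + ∑ (λ j → sgn j * (C zero j * det (minor A j)))
      ≈⟨ +-cong (*-congˡ (∑-cong (λ j → *-congˡ (*-congˡ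
            (det-cong (minor A j) (minor B j) (λ r k → eB (suc r) (λ ()) (punchIn j k)))))))
                (∑-cong (λ j → *-congˡ (*-congˡ
            (det-cong (minor A j) (minor C j) (λ r k → eC (suc r) (λ ()) (punchIn j k)))))) ⟩
    a * det B + det C ∎
    where
    l : ∀ s a b c d → s * ((a * b + c) * d) ≈ a * (s * (b * d)) + s * (c * d)
    l = solve 5 (λ s a b c d → (s :* (((a :* b) :+ c) :* d)) := ((a :* (s :* (b :* d))) :+ (s :* (c :* d)))) refl
  det-rowLinear {suc m} A B C (suc i) a ei eB eC = begin
    ∑ (λ j → sgn j * (A zero j * det (minor A j)))
      ≈⟨ ∑-cong (λ j → *-congˡ (*-congˡ (det-rowLinear (minor A j) (minor B j) (minor C j) i a
            (λ k → ei (punchIn j k))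
            (λ r ne k → eB (suc r) (λ e → ne (suc-injective e)) (punchIn j k))
            (λ r ne k → eC (suc r) (λ e → ne (suc-injective e)) (punchIn j k))))) ⟩
    ∑ (λ j → sgn j * (A zero j * (a * det (minor B j) + det (minor C j))))
      ≈⟨ ∑-cong (λ j → l (sgn j) a (A zero j) (B zero j) (C zero j) (det (minor B j)) (det (minor C j))
             (eB zero (λ ()) j) (eC zero (λ ()) j)) ⟩
    ∑ (λ j → a * (sgn j * (B zero j * det (minor B j))) + sgn j * (C zero j * det (minor C j)))
      ≈⟨ ∑-distrib-+ (λ j → a * (sgn j * (B zero j * det (minor B j)))) (λ j → sgn j * (C zero j * det (minor C j))) ⟩
    ∑ (λ j → a * (sgn j * (B zero j * det (minor B j)))) + ∑ (λ j → sgn j * (C zero j * det (minor C j)))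
      ≈⟨ +-congʳ (sym (*-distribˡ-∑ a (λ j → sgn j * (B zero j * det (minor B j))))) ⟩
    a * det B + det C ∎
    where
    l : ∀ s a x y z d e → x ≈ y → x ≈ z →
        s * (x * (a * d + e)) ≈ a * (s * (y * d)) + s * (z * e)
    l s a x y z d e p q = begin
      s * (x * (a * d + e))  ≈⟨ solve 5 (λ s a x d e → (s :* (x :* ((a :* d) :+ e))) := ((a :* (s :* (x :* d))) :+ (s :* (x :* e)))) refl s a x d e ⟩
      a * (s * (x * d)) + s * (x * e)
        ≈⟨ +-cong (*-congˡ (*-congˡ (*-congʳ p))) (*-congˡ (*-congʳ q)) ⟩
      a * (s * (y * d)) + s * (z * e) ∎

  replaceRows : ∀ {m} → Matrix m → Fin m → Fin m → (Fin m → Carrier) → (Fin m → Carrier) → Matrix m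
  replaceRows A a b x y = replaceAt (replaceAt A a x) b y

  ≡⇒≋ : ∀ {m} {u v : Fin m → Carrier} → u ≡ v → ∀ k → u k ≈ v k
  ≡⇒≋ e k = reflexive (≡.cong (λ f → f k) e)

  Congruent : ∀ {m} → (Matrix m → Carrier) → Set
  Congruent {m} f = ∀ (A B : Matrix m) → (∀ i k → A i k ≈ B i k) → f A ≈ f B

  RowLinear : ∀ {m} → (Matrix m → Carrier) → Set
  RowLinear {m} f = ∀ (A B C : Matrix m) (i : Fin m) (a : Carrier) →
    (∀ k → A i k ≈ a * B i k + C i k) →
    (∀ r → r ≢ i → ∀ k → A r k ≈ B r k) →
    (∀ r → r ≢ i → ∀ k → A r k ≈ C r k) →
    f A ≈ a * f B + f C

  Alternating : ∀ {m} → (Matrix m → Carrier) → Set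
  Alternating {m} f = ∀ (A : Matrix m) i j → i ≢ j → (∀ k → A i k ≈ A j k) → f A ≈ 0#

  module RowSwap {m} (f : Matrix m → Carrier) (fcong : Congruent f) (flin : RowLinear f)
             (A : Matrix m) (a b : Fin m) (a≢b : a ≢ b) where
    replaceRows-a : ∀ x y → replaceRows A a b x y a ≡ x
    replaceRows-a x y = ≡.trans (replaceAt-minimal (replaceAt A a x) b y a a≢b) (replaceAt-updates A a x)

    replaceRows-b : ∀ x y → replaceRows A a b x y b ≡ y
    replaceRows-b x y = replaceAt-updates (replaceAt A a x) b y

    replaceRows-other : ∀ x y r → r ≢ a → r ≢ b → replaceRows A a b x y r ≡ A r
    replaceRows-other x y r na nb = ≡.trans (replaceAt-minimal (replaceAt A a x) b y r nb) (replaceAt-minimal A a x r na)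

    replaceRows-≢a : ∀ x x' y r → r ≢ a → replaceRows A a b x y r ≡ replaceRows A a b x' y r
    replaceRows-≢a x x' y r na with r ≟ b
    ... | yes ≡.refl = ≡.trans (replaceRows-b x y) (≡.sym (replaceRows-b x' y))
    ... | no nb = ≡.trans (replaceRows-other x y r na nb) (≡.sym (replaceRows-other x' y r na nb))

    replaceRows-≢b : ∀ x y y' r → r ≢ b → replaceRows A a b x y r ≡ replaceRows A a b x y' r
    replaceRows-≢b x y y' r nb = ≡.trans (replaceAt-minimal (replaceAt A a x) b y r nb) (≡.sym (replaceAt-minimal (replaceAt A a x) b y' r nb))

    linear-a : ∀ x x' y → f (replaceRows A a b (λ k → x k + x' k) y) ≈ f (replaceRows A a b x y) + f (replaceRows A a b x' y)
    linear-a x x' y = trans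
      (flin (replaceRows A a b (λ k → x k + x' k) y) (replaceRows A a b x y) (replaceRows A a b x' y) a 1#
        (λ k → trans (≡⇒≋ (replaceRows-a (λ k → x k + x' k) y) k)
                 (+-cong (trans (sym (*-identityˡ _)) (*-congˡ (sym (≡⇒≋ (replaceRows-a x y) k))))
                         (sym (≡⇒≋ (replaceRows-a x' y) k))))
        (λ r na k → ≡⇒≋ (replaceRows-≢a (λ k → x k + x' k) x y r na) k)
        (λ r na k → ≡⇒≋ (replaceRows-≢a (λ k → x k + x' k) x' y r na) k))
      (+-congʳ (*-identityˡ _))

    linear-b : ∀ x y y' → f (replaceRows A a b x (λ k → y k + y' k)) ≈ f (replaceRows A a b x y) + f (replaceRows A a b x y')
    linear-b x y y' = trans
      (flin (replaceRows A a b x (λ k → y k + y' k)) (replaceRows A a b x y) (replaceRows A a b x y') b 1#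
        (λ k → trans (≡⇒≋ (replaceRows-b x (λ k → y k + y' k)) k)
                 (+-cong (trans (sym (*-identityˡ _)) (*-congˡ (sym (≡⇒≋ (replaceRows-b x y) k))))
                         (sym (≡⇒≋ (replaceRows-b x y') k))))
        (λ r nb k → ≡⇒≋ (replaceRows-≢b x (λ k → y k + y' k) y r nb) k)
        (λ r nb k → ≡⇒≋ (replaceRows-≢b x (λ k → y k + y' k) y' r nb) k))
      (+-congʳ (*-identityˡ _))

    swap-negates : Alternating f → f (replaceRows A a b (A b) (A a)) ≈ - f A
    swap-negates f-alternating = inverseʳ-unique (f A) (f (replaceRows A a b (A b) (A a))) (sym 0≈fA+f-ba)
      where
      a+b : Fin m → Carrier
      a+b k = A a k + A b k
      f-ss≈0 : f (replaceRows A a b a+b a+b) ≈ 0#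
      f-ss≈0 = f-alternating (replaceRows A a b a+b a+b) a b a≢b (λ k → trans (≡⇒≋ (replaceRows-a a+b a+b) k) (sym (≡⇒≋ (replaceRows-b a+b a+b) k)))
      f-aa≈0 : f (replaceRows A a b (A a) (A a)) ≈ 0#
      f-aa≈0 = f-alternating (replaceRows A a b (A a) (A a)) a b a≢b (λ k → trans (≡⇒≋ (replaceRows-a (A a) (A a)) k) (sym (≡⇒≋ (replaceRows-b (A a) (A a)) k)))
      f-bb≈0 : f (replaceRows A a b (A b) (A b)) ≈ 0#
      f-bb≈0 = f-alternating (replaceRows A a b (A b) (A b)) a b a≢b (λ k → trans (≡⇒≋ (replaceRows-a (A b) (A b)) k) (sym (≡⇒≋ (replaceRows-b (A b) (A b)) k)))
      f-ab≈fA : f (replaceRows A a b (A a) (A b)) ≈ f A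
      f-ab≈fA = fcong _ _ (λ r k → pt r k)
        where
        pt : ∀ r k → replaceRows A a b (A a) (A b) r k ≈ A r k
        pt r k with r ≟ a | r ≟ b
        ... | yes ≡.refl | _ = ≡⇒≋ (replaceRows-a (A a) (A b)) k
        ... | no na | yes ≡.refl = ≡⇒≋ (replaceRows-b (A a) (A b)) k
        ... | no na | no nb = ≡⇒≋ (replaceRows-other (A a) (A b) r na nb) k
      0≈fA+f-ba : 0# ≈ f A + f (replaceRows A a b (A b) (A a))
      0≈fA+f-ba = begin
        0#   ≈⟨ sym f-ss≈0 ⟩
        f (replaceRows A a b a+b a+b)  ≈⟨ linear-a (A a) (A b) a+b ⟩
        f (replaceRows A a b (A a) a+b) + f (replaceRows A a b (A b) a+b)
          ≈⟨ +-cong (linear-b (A a) (A a) (A b)) (linear-b (A b) (A a) (A b)) ⟩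
        (f (replaceRows A a b (A a) (A a)) + f (replaceRows A a b (A a) (A b)))
          + (f (replaceRows A a b (A b) (A a)) + f (replaceRows A a b (A b) (A b)))
          ≈⟨ +-cong (+-cong f-aa≈0 f-ab≈fA) (+-congˡ f-bb≈0) ⟩
        (0# + f A) + (f (replaceRows A a b (A b) (A a)) + 0#)
          ≈⟨ +-cong (+-identityˡ _) (+-identityʳ _) ⟩
        f A + f (replaceRows A a b (A b) (A a)) ∎

  det-swap-lowerRows : ∀ {m} → Alternating (det {m}) → (A : Matrix (suc m)) (a b : Fin m) → a ≢ b →
    det (replaceRows A (suc a) (suc b) (A (suc b)) (A (suc a))) ≈ - det A
  det-swap-lowerRows {m} det-alternating-minors A a b a≢b = begin
    ∑ (λ c → sgn c * (A zero c * det (minor A' c)))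
      ≈⟨ ∑-cong (λ c → *-congˡ (*-congˡ (trans (det-cong (minor A' c) _ (minor-swap c))
            (RowSwap.swap-negates det det-cong det-rowLinear (minor A c) a b a≢b det-alternating-minors)))) ⟩
    ∑ (λ c → sgn c * (A zero c * - det (minor A c)))
      ≈⟨ ∑-cong (λ c → sign-pull (sgn c) (A zero c) (det (minor A c))) ⟩
    ∑ (λ c → - (sgn c * (A zero c * det (minor A c))))
      ≈⟨ sym (-‿distrib-∑ (λ c → sgn c * (A zero c * det (minor A c)))) ⟩
    - det A ∎
    where
    A' : Matrix (suc m)
    A' = replaceRows A (suc a) (suc b) (A (suc b)) (A (suc a))
    minor-swap : ∀ c i k → minor A' c i k ≈ replaceRows (minor A c) a b (minor A c b) (minor A c a) i k
    minor-swap c i k = trans (reflexive (replaceAt-precompose (replaceAt (λ r → A (suc r)) a (A (suc b))) b (A (suc a)) (punchIn c) i k))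
      (replaceAt-cong (λ r k → replaceAt (λ r → A (suc r)) a (A (suc b)) r (punchIn c k))
                (replaceAt (minor A c) a (minor A c b)) b
                (λ k → A (suc a) (punchIn c k)) (λ k → A (suc a) (punchIn c k))
                (λ r k → reflexive (replaceAt-precompose (λ r → A (suc r)) a (A (suc b)) (punchIn c) r k))
                (λ k → refl) i k)
    sign-pull : ∀ s x d → s * (x * - d) ≈ - (s * (x * d))
    sign-pull = solve 3 (λ s x d → (s :* (x :* (:- d))) := (:- (s :* (x :* d)))) refl

  -- Expanding along both top rows, the term for (j , k) cancels the term for the swapped pair.
  det-equalTopRows≈0 : ∀ {m} (A : Matrix (suc (suc m))) → (∀ k → A zero k ≈ A (suc zero) k) → det A ≈ 0#
  det-equalTopRows≈0 {m} A e = begin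
    det A ≈⟨ ∑-cong (λ j → trans (*-congˡ (*-distribˡ-∑ (A zero j) (λ k → sgn k * (A (suc zero) (punchIn j k) * det (minor² j k)))))
                                 (*-distribˡ-∑ (sgn j) (λ k → A zero j * (sgn k * (A (suc zero) (punchIn j k) * det (minor² j k)))))) ⟩
    ∑ (λ j → ∑ (λ k → term j k)) ≈⟨ antisymmetric-∑≈0 term term-antisymmetric ⟩
    0# ∎
    where
    minor² : Fin (suc (suc m)) → Fin (suc m) → Matrix m
    minor² j k i l = A (suc (suc i)) (punchIn j (punchIn k l))
    term : Fin (suc (suc m)) → Fin (suc m) → Carrier
    term j k = sgn j * (A zero j * (sgn k * (A (suc zero) (punchIn j k) * det (minor² j k))))
    paired-terms-cancel : ∀ sj sk sc sk' x y d → sc * sk' ≈ - (sj * sk) →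
         sj * (x * (sk * (y * d))) + sc * (y * (sk' * (x * d))) ≈ 0#
    paired-terms-cancel sj sk sc sk' x y d p = begin
      sj * (x * (sk * (y * d))) + sc * (y * (sk' * (x * d)))
        ≈⟨ solve 7 (λ sj sk sc sk' x y d → ((sj :* (x :* (sk :* (y :* d)))) :+ (sc :* (y :* (sk' :* (x :* d)))))
                   := (((sj :* sk) :* (x :* (y :* d))) :+ ((sc :* sk') :* (x :* (y :* d))))) refl sj sk sc sk' x y d ⟩
      (sj * sk) * (x * (y * d)) + (sc * sk') * (x * (y * d))
        ≈⟨ +-congˡ (*-congʳ p) ⟩
      (sj * sk) * (x * (y * d)) + (- (sj * sk)) * (x * (y * d))
        ≈⟨ solve 2 (λ a b → ((a :* b) :+ ((:- a) :* b)) := con (+ 0)) refl (sj * sk) (x * (y * d)) ⟩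
      0# ∎
    term-antisymmetric : ∀ j k → term j k + term (punchIn j k) (swapIndex j k) ≈ 0#
    term-antisymmetric j k = trans (+-congˡ (*-congˡ (*-cong (e (punchIn j k)) (*-congˡ (*-cong
                    (trans (reflexive (≡.cong (A (suc zero)) (punchIn-swapIndex j k))) (sym (e j)))
                    (det-cong (minor² (punchIn j k) (swapIndex j k)) (minor² j k)
                       (λ i l → reflexive (≡.cong (A (suc (suc i))) (punchIn²-swapIndex j k l)))))))))
               (paired-terms-cancel (sgn j) (sgn k) (sgn (punchIn j k)) (sgn (swapIndex j k)) (A zero j)
                   (A (suc zero) (punchIn j k)) (det (minor² j k)) (sgn-swapIndex j k))

  det-alternating : ∀ {m} → Alternating (det {m})
  det-repeatsTopRow≈0 : ∀ {m} (A : Matrix (suc m)) (j : Fin m) → (∀ k → A zero k ≈ A (suc j) k) → det A ≈ 0#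

  det-alternating {suc m} A zero zero ne e = ⊥-elim (ne ≡.refl)
  det-alternating {suc m} A zero (suc j) ne e = det-repeatsTopRow≈0 A j e
  det-alternating {suc m} A (suc i) zero ne e = det-repeatsTopRow≈0 A i (λ k → sym (e k))
  det-alternating {suc m} A (suc i) (suc j) ne e =
    ∑-≈0 (λ c → sgn c * (A zero c * det (minor A c)))
        (λ c → trans (*-congˡ (*-congˡ (det-alternating (minor A c) i j (λ p → ne (≡.cong suc p)) (λ k → e (punchIn c k)))))
                     (trans (*-congˡ (zeroʳ _)) (zeroʳ _)))

  det-repeatsTopRow≈0 {suc m} A zero e = det-equalTopRows≈0 A e
  det-repeatsTopRow≈0 {suc m} A (suc j) e = begin
    det A   ≈⟨ sym (-‿involutive _) ⟩
    - (- det A) ≈⟨ -‿cong (sym (det-swap-lowerRows (det-alternating {suc m}) A zero (suc j) (λ ()))) ⟩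
    - det A'    ≈⟨ -‿cong (det-equalTopRows≈0 A' e) ⟩
    - 0#        ≈⟨ -0#≈0# ⟩
    0# ∎
    where
    A' : Matrix (suc (suc m))
    A' = replaceRows A (suc zero) (suc (suc j)) (A (suc (suc j))) (A (suc zero))

  moveToFront : ∀ {m} → Fin (suc m) → Fin (suc m) → Fin (suc m)
  moveToFront j zero    = j
  moveToFront j (suc i) = punchIn j i

  punchIn-inject₁-self : ∀ {m} (j : Fin (suc m)) → punchIn (inject₁ j) j ≡ suc j
  punchIn-inject₁-self zero = ≡.refl
  punchIn-inject₁-self {suc m} (suc j) = ≡.cong suc (punchIn-inject₁-self j)

  punchIn-suc-self : ∀ {m} (j : Fin (suc m)) → punchIn (suc j) j ≡ inject₁ j
  punchIn-suc-self zero = ≡.refl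
  punchIn-suc-self {suc m} (suc j) = ≡.cong suc (punchIn-suc-self j)

  punchIn-inject₁≡punchIn-suc : ∀ {m} (j i : Fin (suc m)) → i ≢ j → punchIn (inject₁ j) i ≡ punchIn (suc j) i
  punchIn-inject₁≡punchIn-suc zero zero ne = ⊥-elim (ne ≡.refl)
  punchIn-inject₁≡punchIn-suc zero (suc i) ne = ≡.refl
  punchIn-inject₁≡punchIn-suc {suc m} (suc j) zero ne = ≡.refl
  punchIn-inject₁≡punchIn-suc {suc m} (suc j) (suc i) ne = ≡.cong suc (punchIn-inject₁≡punchIn-suc j i (λ e → ne (≡.cong suc e)))

  sgn-inject₁ : ∀ {m} (j : Fin m) → sgn (inject₁ j) ≈ sgn j
  sgn-inject₁ zero = refl
  sgn-inject₁ (suc j) = -‿cong (sgn-inject₁ j)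

  moveToFront-sign′ : ∀ {m} (f : Matrix (suc m) → Carrier) → Congruent f → RowLinear f → Alternating f →
    ∀ (X : Matrix (suc m)) (n : ℕ) j → toℕ j ≡ n → f (λ r → X (moveToFront j r)) ≈ sgn j * f X
  moveToFront-sign′ f fc fl fa X n zero _ = trans (fc _ X pt) (sym (*-identityˡ _))
    where
    pt : ∀ r k → X (moveToFront zero r) k ≈ X r k
    pt zero k = refl
    pt (suc r) k = refl
  moveToFront-sign′ {suc m} f fc fl fa X (suc n) (suc j) tj = begin
    f (λ r → X (moveToFront (suc j) r))   ≈⟨ fc _ _ pt ⟩
    f (replaceRows F zero (suc j) (F (suc j)) (F zero))  ≈⟨ RowSwap.swap-negates f fc fl F zero (suc j) (λ ()) fa ⟩
    - f F     ≈⟨ -‿cong (moveToFront-sign′ f fc fl fa X n (inject₁ j) (≡.trans (toℕ-inject₁ j) (ℕₚ.suc-injective tj))) ⟩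
    - (sgn (inject₁ j) * f X)  ≈⟨ -‿distribˡ-* _ _ ⟩
    (- sgn (inject₁ j)) * f X  ≈⟨ *-congʳ (-‿cong (sgn-inject₁ j)) ⟩
    (- sgn j) * f X ∎
    where
    F : Matrix (suc (suc m))
    F r = X (moveToFront (inject₁ j) r)
    x y : Fin (suc (suc m)) → Carrier
    x = F (suc j)
    y = F zero
    pt : ∀ r k → X (moveToFront (suc j) r) k ≈ replaceRows F zero (suc j) x y r k
    pt zero k = reflexive (≡.cong (λ c → X c k) (≡.sym (punchIn-inject₁-self j)))
    pt (suc i) k with i ≟ j
    ... | yes ≡.refl = trans (reflexive (≡.cong (λ c → X c k) (punchIn-suc-self i)))
                             (sym (≡⇒≋ (replaceAt-updates (λ k → replaceAt F zero x (suc k)) i y) k))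
    ... | no ne = trans (reflexive (≡.cong (λ c → X c k) (≡.sym (punchIn-inject₁≡punchIn-suc j i ne))))
                        (sym (≡⇒≋ (replaceAt-minimal (λ k → replaceAt F zero x (suc k)) j y i ne) k))

  moveToFront-sign : ∀ {m} (f : Matrix (suc m) → Carrier) → Congruent f → RowLinear f → Alternating f →
    ∀ (X : Matrix (suc m)) j → f (λ r → X (moveToFront j r)) ≈ sgn j * f X
  moveToFront-sign f fc fl fa X j = moveToFront-sign′ f fc fl fa X (toℕ j) j ≡.refl

  sgn-square : ∀ {m} (i : Fin m) → sgn i * sgn i ≈ 1#
  sgn-square zero = *-identityˡ _
  sgn-square (suc i) = trans (solve 1 (λ x → ((:- x) :* (:- x)) := (x :* x)) refl (sgn i)) (sgn-square i)

  minorAt : ∀ {m} → Matrix (suc m) → Fin (suc m) → Fin (suc m) → Matrix m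
  minorAt A i k p q = A (punchIn i p) (punchIn k q)

  cofactor : ∀ {m} → Matrix (suc m) → Fin (suc m) → Fin (suc m) → Carrier
  cofactor A i k = sgn i * (sgn k * det (minorAt A i k))

  det-expandRow : ∀ {m} (A : Matrix (suc m)) (i : Fin (suc m)) → det A ≈ ∑ (λ k → A i k * cofactor A i k)
  det-expandRow A i = begin
    det A                         ≈⟨ sym (*-identityˡ _) ⟩
    1# * det A                    ≈⟨ *-congʳ (sym (sgn-square i)) ⟩
    (sgn i * sgn i) * det A       ≈⟨ *-assoc _ _ _ ⟩
    sgn i * (sgn i * det A)       ≈⟨ *-congˡ (sym (moveToFront-sign det det-cong det-rowLinear det-alternating A i)) ⟩
    sgn i * ∑ (λ k → sgn k * (A i k * det (minorAt A i k)))
       ≈⟨ *-distribˡ-∑ (sgn i) (λ k → sgn k * (A i k * det (minorAt A i k))) ⟩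
    ∑ (λ k → sgn i * (sgn k * (A i k * det (minorAt A i k))))
       ≈⟨ ∑-cong (λ k → solve 4 (λ a b c d → (a :* (b :* (c :* d))) := (c :* (a :* (b :* d)))) refl
                          (sgn i) (sgn k) (A i k) (det (minorAt A i k))) ⟩
    ∑ (λ k → A i k * cofactor A i k) ∎

  adjugate-identity : ∀ {m} (A : Matrix (suc m)) (i j : Fin (suc m)) →
    ∑ (λ k → A i k * cofactor A j k) ≈ δ i j * det A
  adjugate-identity {m} A i j = begin
    ∑ (λ k → A i k * cofactor A j k)   ≈⟨ ∑-cong (λ k → *-cong (reflexive (≡.sym (≡.cong (λ r → r k) (replaceAt-updates A j (A i)))))
                                        (*-congˡ (*-congˡ (det-cong (minorAt A j k) (minorAt A' j k)
                                           (λ p q → reflexive (≡.sym (≡.cong (λ r → r (punchIn k q))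
                                              (replaceAt-minimal A j (A i) (punchIn j p) (punchInᵢ≢i j p))))))))) ⟩
    ∑ (λ k → A' j k * cofactor A' j k)  ≈⟨ sym (det-expandRow A' j) ⟩
    det A'  ≈⟨ fin ⟩
    δ i j * det A ∎
    where
    A' : Matrix (suc m)
    A' = replaceAt A j (A i)
    fin : det A' ≈ δ i j * det A
    fin with i ≟ j
    ... | yes ≡.refl = trans (det-cong A' A (λ r k → pt r k)) (trans (sym (*-identityˡ _)) (*-congʳ (sym (δ-refl i))))
      where
      pt : ∀ r k → A' r k ≈ A r k
      pt r k with r ≟ i
      ... | yes ≡.refl = ≡⇒≋ (replaceAt-updates A i (A i)) k
      ... | no ne = ≡⇒≋ (replaceAt-minimal A i (A i) r ne) k
    ... | no ne = trans (det-alternating A' i j ne (λ k → trans (≡⇒≋ (replaceAt-minimal A j (A i) i ne) k) (sym (≡⇒≋ (replaceAt-updates A j (A i)) k))))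
                        (sym (trans (*-congʳ (δ-≢ i j ne)) (zeroˡ _)))

  padAt : ∀ {m} → Fin (suc m) → (Fin m → Carrier) → Fin (suc m) → Carrier
  padAt j r = insertAt r j 0#

  padAt-cong : ∀ {m} (j : Fin (suc m)) (r r' : Fin m → Carrier) → (∀ k → r k ≈ r' k) → ∀ k → padAt j r k ≈ padAt j r' k
  padAt-cong zero r r' e zero = refl
  padAt-cong zero r r' e (suc k) = e k
  padAt-cong {suc m} (suc j) r r' e zero = e zero
  padAt-cong {suc m} (suc j) r r' e (suc k) = padAt-cong j (λ k → r (suc k)) (λ k → r' (suc k)) (λ k → e (suc k)) k

  padAt-linear : ∀ {m} (j : Fin (suc m)) a (r s : Fin m → Carrier) k →
    padAt j (λ k → a * r k + s k) k ≈ a * padAt j r k + padAt j s k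
  padAt-linear zero a r s zero = sym (trans (+-congʳ (zeroʳ a)) (+-identityˡ _))
  padAt-linear zero a r s (suc k) = refl
  padAt-linear {suc m} (suc j) a r s zero = refl
  padAt-linear {suc m} (suc j) a r s (suc k) = padAt-linear j a (λ k → r (suc k)) (λ k → s (suc k)) k

  padAt-0 : ∀ {m} (j : Fin (suc m)) k → padAt j (λ _ → 0#) k ≈ 0#
  padAt-0 zero zero = refl
  padAt-0 zero (suc k) = refl
  padAt-0 {suc m} (suc j) zero = refl
  padAt-0 {suc m} (suc j) (suc k) = padAt-0 j k

  padAt-δ : ∀ {m} (j : Fin (suc m)) (i : Fin m) k → padAt j (δ i) k ≈ δ (punchIn j i) k
  padAt-δ zero i zero = refl
  padAt-δ zero i (suc k) = refl
  padAt-δ {suc m} (suc j) zero zero = refl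
  padAt-δ {suc m} (suc j) (suc i) zero = refl
  padAt-δ {suc m} (suc j) zero (suc k) = padAt-0 j k
  padAt-δ {suc m} (suc j) (suc i) (suc k) = padAt-δ j i k

  padAt-split : ∀ {m} (j : Fin (suc m)) (r : Fin (suc m) → Carrier) k →
    r k ≈ padAt j (λ k' → r (punchIn j k')) k + r j * δ j k
  padAt-split zero r zero = sym (trans (+-identityˡ _) (*-identityʳ _))
  padAt-split zero r (suc k) = sym (trans (+-congˡ (zeroʳ _)) (+-identityʳ _))
  padAt-split {suc m} (suc j) r zero = sym (trans (+-congˡ (zeroʳ _)) (+-identityʳ _))
  padAt-split {suc m} (suc j) r (suc k) = padAt-split j (λ k → r (suc k)) k

  replaceAt-self : ∀ {m} {A : Set} (X : Fin m → A) i r → replaceAt X i (X i) r ≡ X r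
  replaceAt-self X i = updateAt-id-local i X ≡.refl

  rowLinear-∑ : ∀ {n p} (f : Matrix n → Carrier) → RowLinear f →
    ∀ (M : Matrix n) (i : Fin n) (c : Fin p → Carrier) (v : Fin p → Fin n → Carrier) →
    f (replaceAt M i (λ k → ∑ (λ t → c t * v t k))) ≈ ∑ (λ t → c t * f (replaceAt M i (v t)))
  rowLinear-∑ {n} {zero} f fl M i c v = trans fZ (sym (reflexive (∑-zero _)))
    where
    Z : Matrix n
    Z = replaceAt M i (λ k → ∑ (λ t → c t * v t k))
    fZ : f Z ≈ 0#
    fZ = x+x≈x⇒x≈0 (f Z) (sym (trans (fl Z Z Z i 1#
           (λ k → trans (≡⇒≋ (replaceAt-updates M i _) k) (trans (reflexive (∑-zero _))
                  (sym (trans (+-cong (trans (*-identityˡ _) (trans (≡⇒≋ (replaceAt-updates M i _) k) (reflexive (∑-zero _))))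
                                      (trans (≡⇒≋ (replaceAt-updates M i _) k) (reflexive (∑-zero _)))) (+-identityˡ _)))))
           (λ r _ k → refl) (λ r _ k → refl)) (+-congʳ (*-identityˡ _))))
  rowLinear-∑ {p = suc p} f fl M i c v = begin
    f (replaceAt M i (λ k → ∑ (λ t → c t * v t k)))
      ≈⟨ fl _ (replaceAt M i (v zero)) (replaceAt M i (λ k → ∑ (λ t → c (suc t) * v (suc t) k))) i (c zero)
            (λ k → trans (≡⇒≋ (replaceAt-updates M i _) k) (trans (reflexive (∑-suc _))
                    (sym (+-cong (*-congˡ (≡⇒≋ (replaceAt-updates M i _) k)) (≡⇒≋ (replaceAt-updates M i _) k)))))
            (λ r ne k → trans (≡⇒≋ (replaceAt-minimal M i _ r ne) k) (sym (≡⇒≋ (replaceAt-minimal M i _ r ne) k)))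
            (λ r ne k → trans (≡⇒≋ (replaceAt-minimal M i _ r ne) k) (sym (≡⇒≋ (replaceAt-minimal M i _ r ne) k))) ⟩
    c zero * f (replaceAt M i (v zero)) + f (replaceAt M i (λ k → ∑ (λ t → c (suc t) * v (suc t) k)))
      ≈⟨ +-congˡ (rowLinear-∑ f fl M i (λ t → c (suc t)) (λ t → v (suc t))) ⟩
    c zero * f (replaceAt M i (v zero)) + ∑ (λ t → c (suc t) * f (replaceAt M i (v (suc t))))
      ≈⟨ sym (reflexive (∑-suc _)) ⟩
    ∑ (λ t → c t * f (replaceAt M i (v t))) ∎

  module RowReduction {m} (f : Matrix (suc m) → Carrier) (fc : Congruent f) (fl : RowLinear f) (fa : Alternating f)
             (j : Fin (suc m)) where

    add-topRow-multiple : ∀ (X : Matrix (suc m)) (i : Fin m) (u u' : Fin (suc m) → Carrier) (c : Carrier) →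
      (∀ k → X zero k ≈ δ j k) → (∀ k → u k ≈ u' k + c * δ j k) →
      f (replaceAt X (suc i) u) ≈ f (replaceAt X (suc i) u')
    add-topRow-multiple X i u u' c hz hu = trans
      (fl (replaceAt X (suc i) u) (replaceAt X (suc i) (δ j)) (replaceAt X (suc i) u') (suc i) c
        (λ k → trans (≡⇒≋ (replaceAt-updates X (suc i) u) k) (trans (hu k) (trans (+-comm _ _)
                 (sym (+-cong (*-congˡ (≡⇒≋ (replaceAt-updates X (suc i) (δ j)) k)) (≡⇒≋ (replaceAt-updates X (suc i) u') k))))))
        (λ r ne k → trans (≡⇒≋ (replaceAt-minimal X (suc i) u r ne) k) (sym (≡⇒≋ (replaceAt-minimal X (suc i) (δ j) r ne) k)))
        (λ r ne k → trans (≡⇒≋ (replaceAt-minimal X (suc i) u r ne) k) (sym (≡⇒≋ (replaceAt-minimal X (suc i) u' r ne) k))))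
      (trans (+-congʳ (trans (*-congˡ f-repeatedTop≈0) (zeroʳ c))) (+-identityˡ _))
      where
      f-repeatedTop≈0 : f (replaceAt X (suc i) (δ j)) ≈ 0#
      f-repeatedTop≈0 = fa _ zero (suc i) (λ ()) (λ k → trans (hz k) (sym (≡⇒≋ (replaceAt-updates X (suc i) (δ j)) k)))

    module _ (M M' : Matrix (suc m)) (c : Fin m → Carrier)
             (h0 : ∀ k → M zero k ≈ δ j k) (h0' : ∀ k → M' zero k ≈ δ j k)
             (hr : ∀ i k → M (suc i) k ≈ M' (suc i) k + c i * δ j k) where

      partlyReduced : List (Fin m) → Matrix (suc m)
      partlyReduced [] = M
      partlyReduced (i ∷ is) = replaceAt (partlyReduced is) (suc i) (M' (suc i))

      partlyReduced-top : ∀ is → partlyReduced is zero ≡ M zero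
      partlyReduced-top [] = ≡.refl
      partlyReduced-top (i ∷ is) = partlyReduced-top is

      partlyReduced-rows : ∀ is i → Σ[ e ∈ Carrier ] (∀ k → partlyReduced is (suc i) k ≈ M' (suc i) k + e * δ j k)
      partlyReduced-rows [] i = c i , hr i
      partlyReduced-rows (i0 ∷ is) i with i ≟ i0
      ... | yes ≡.refl = 0# , (λ k → trans (≡⇒≋ (replaceAt-updates (partlyReduced is) (suc i) (M' (suc i))) k)
                                       (sym (trans (+-congˡ (zeroˡ _)) (+-identityʳ _))))
      ... | no ne = proj₁ (partlyReduced-rows is i) ,
                    (λ k → trans (≡⇒≋ (replaceAt-minimal (partlyReduced is) (suc i0) (M' (suc i0)) (suc i) (λ e → ne (suc-injective e))) k)
                                 (proj₂ (partlyReduced-rows is i) k))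

      partlyReduced-invariant : ∀ is → f (partlyReduced is) ≈ f M
      partlyReduced-invariant [] = refl
      partlyReduced-invariant (i0 ∷ is) = begin
        f (replaceAt (partlyReduced is) (suc i0) (M' (suc i0)))
          ≈⟨ sym (add-topRow-multiple (partlyReduced is) i0 (partlyReduced is (suc i0)) (M' (suc i0)) (proj₁ (partlyReduced-rows is i0))
                   (λ k → trans (≡⇒≋ (partlyReduced-top is) k) (h0 k)) (proj₂ (partlyReduced-rows is i0))) ⟩
        f (replaceAt (partlyReduced is) (suc i0) (partlyReduced is (suc i0)))
          ≈⟨ fc _ _ (λ r k → ≡⇒≋ (replaceAt-self (partlyReduced is) (suc i0) r) k) ⟩
        f (partlyReduced is)  ≈⟨ partlyReduced-invariant is ⟩
        f M ∎

      partlyReduced-complete : ∀ is i → i ∈ is → partlyReduced is (suc i) ≡ M' (suc i)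
      partlyReduced-complete (i0 ∷ is) i (here ≡.refl) = replaceAt-updates (partlyReduced is) (suc i) (M' (suc i))
      partlyReduced-complete (i0 ∷ is) i (there p) with i ≟ i0
      ... | yes ≡.refl = replaceAt-updates (partlyReduced is) (suc i) (M' (suc i))
      ... | no ne = ≡.trans (replaceAt-minimal (partlyReduced is) (suc i0) (M' (suc i0)) (suc i) (λ e → ne (suc-injective e)))
                            (partlyReduced-complete is i p)

      reduce-invariant : f M' ≈ f M
      reduce-invariant = trans (fc M' (partlyReduced (allFin m)) pt) (partlyReduced-invariant (allFin m))
        where
        pt : ∀ r k → M' r k ≈ partlyReduced (allFin m) r k
        pt zero k = trans (h0' k) (trans (sym (h0 k)) (sym (≡⇒≋ (partlyReduced-top (allFin m)) k)))
        pt (suc i) k = sym (≡⇒≋ (partlyReduced-complete (allFin m) i (∈-allFin i)) k)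

  alternating≈det* : ∀ {m} (f : Matrix m → Carrier) → Congruent f → RowLinear f → Alternating f → ∀ A → f A ≈ det A * f δ
  alternating≈det* {zero} f fc fl fa A = trans (fc A δ (λ ())) (sym (*-identityˡ _))
  alternating≈det* {suc m} f fc fl fa A = begin
    f A  ≈⟨ fc A (replaceAt A zero (λ k → ∑ (λ j → A zero j * δ j k))) top-row-expanded ⟩
    f (replaceAt A zero (λ k → ∑ (λ j → A zero j * δ j k)))
       ≈⟨ rowLinear-∑ f fl A zero (A zero) δ ⟩
    ∑ (λ j → A zero j * f (replaceAt A zero (δ j)))
       ≈⟨ ∑-cong (λ j → *-congˡ (f-unitTopRow j)) ⟩
    ∑ (λ j → A zero j * (det (minor A j) * (sgn j * f δ)))
       ≈⟨ ∑-cong (λ j → solve 4 (λ a d s x → (a :* (d :* (s :* x))) := ((s :* (a :* d)) :* x)) refl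
                           (A zero j) (det (minor A j)) (sgn j) (f δ)) ⟩
    ∑ (λ j → (sgn j * (A zero j * det (minor A j))) * f δ)
       ≈⟨ sym (*-distribʳ-∑ (f δ) (λ j → sgn j * (A zero j * det (minor A j)))) ⟩
    det A * f δ ∎
    where
    top-row-expanded : ∀ r k → A r k ≈ replaceAt A zero (λ k → ∑ (λ j → A zero j * δ j k)) r k
    top-row-expanded zero k = sym (∑-*δ (A zero) k)
    top-row-expanded (suc r) k = refl
    f-unitTopRow : ∀ j → f (replaceAt A zero (δ j)) ≈ det (minor A j) * (sgn j * f δ)
    f-unitTopRow j = begin
      f (replaceAt A zero (δ j))  ≈⟨ sym (RowReduction.reduce-invariant f fc fl fa j (replaceAt A zero (δ j)) (B (minor A j)) (λ i → A (suc i) j)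
                                     (λ k → refl) (λ k → refl) (λ i k → padAt-split j (A (suc i)) k)) ⟩
      g (minor A j)         ≈⟨ alternating≈det* g gc gl ga (minor A j) ⟩
      det (minor A j) * g δ ≈⟨ *-congˡ gδ ⟩
      det (minor A j) * (sgn j * f δ) ∎
      where
      B : Matrix m → Matrix (suc m)
      B C zero = δ j
      B C (suc i) = padAt j (C i)
      g : Matrix m → Carrier
      g C = f (B C)
      gc : Congruent g
      gc X Y e = fc (B X) (B Y) pt
        where
        pt : ∀ r k → B X r k ≈ B Y r k
        pt zero k = refl
        pt (suc i) k = padAt-cong j (X i) (Y i) (e i) k
      gl : RowLinear g
      gl X Y Z i a er e1 e2 = fl (B X) (B Y) (B Z) (suc i) a
        (λ k → trans (padAt-cong j (X i) _ er k) (padAt-linear j a (Y i) (Z i) k))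
        (λ { zero _ k → refl ; (suc r) ne k → padAt-cong j (X r) (Y r) (e1 r (λ p → ne (≡.cong suc p))) k })
        (λ { zero _ k → refl ; (suc r) ne k → padAt-cong j (X r) (Z r) (e2 r (λ p → ne (≡.cong suc p))) k })
      ga : Alternating g
      ga X i i' ne e = fa (B X) (suc i) (suc i') (λ p → ne (suc-injective p)) (padAt-cong j (X i) (X i') e)
      gδ : g δ ≈ sgn j * f δ
      gδ = trans (fc (B δ) (λ r → δ (moveToFront j r)) pt) (moveToFront-sign f fc fl fa δ j)
        where
        pt : ∀ r k → B δ r k ≈ δ (moveToFront j r) k
        pt zero k = refl
        pt (suc i) k = padAt-δ j i k

  mul : ∀ {m} → Matrix m → Matrix m → Matrix m
  mul A B i k = ∑ (λ t → A i t * B t k)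

  det-mul : ∀ {m} (A B : Matrix m) → det (mul A B) ≈ det A * det B
  det-mul {m} A B = trans (alternating≈det* f fc fl fa A) (*-congˡ (det-cong (mul δ B) B (λ i k → ∑-δ* (λ t → B t k) i)))
    where
    f : Matrix m → Carrier
    f X = det (mul X B)
    fc : Congruent f
    fc X Y e = det-cong _ _ (λ i k → ∑-cong (λ t → *-congʳ (e i t)))
    fl : RowLinear f
    fl X Y Z i a er e1 e2 = det-rowLinear (mul X B) (mul Y B) (mul Z B) i a
      (λ k → begin
         ∑ (λ t → X i t * B t k)  ≈⟨ ∑-cong (λ t → trans (*-congʳ (er t)) (distribʳ _ _ _)) ⟩
         ∑ (λ t → (a * Y i t) * B t k + Z i t * B t k)
           ≈⟨ ∑-distrib-+ (λ t → (a * Y i t) * B t k) (λ t → Z i t * B t k) ⟩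
         ∑ (λ t → (a * Y i t) * B t k) + ∑ (λ t → Z i t * B t k)
           ≈⟨ +-congʳ (trans (∑-cong (λ t → *-assoc _ _ _)) (sym (*-distribˡ-∑ a (λ t → Y i t * B t k)))) ⟩
         a * ∑ (λ t → Y i t * B t k) + ∑ (λ t → Z i t * B t k) ∎)
      (λ r ne k → ∑-cong (λ t → *-congʳ (e1 r ne t)))
      (λ r ne k → ∑-cong (λ t → *-congʳ (e2 r ne t)))
    fa : Alternating f
    fa X i j ne e = det-alternating (mul X B) i j ne (λ k → ∑-cong (λ t → *-congʳ (e t)))

  det-identity : ∀ {m} → det {m} δ ≈ 1#
  det-identity {zero} = refl
  det-identity {suc m} = begin
    det {suc m} δ   ≡⟨ ∑-suc _ ⟩
    1# * (1# * det {m} δ) + ∑ (λ j → sgn (suc j) * (0# * det (minor δ (suc j))))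
      ≈⟨ +-cong (trans (*-identityˡ _) (trans (*-identityˡ _) (det-identity {m})))
                (∑-≈0 (λ j → sgn (suc j) * (0# * det (minor δ (suc j)))) (λ j → trans (*-congˡ (zeroˡ _)) (zeroʳ _))) ⟩
    1# + 0#  ≈⟨ +-identityʳ _ ⟩
    1# ∎

  mul-assoc : ∀ {m} (A B C : Matrix m) i j → mul (mul A B) C i j ≈ mul A (mul B C) i j
  mul-assoc A B C i j = begin
    ∑ (λ k → ∑ (λ t → A i t * B t k) * C k j)
      ≈⟨ ∑-cong (λ k → *-distribʳ-∑ (C k j) (λ t → A i t * B t k)) ⟩
    ∑ (λ k → ∑ (λ t → (A i t * B t k) * C k j))
      ≈⟨ ∑-comm (λ k t → (A i t * B t k) * C k j) ⟩
    ∑ (λ t → ∑ (λ k → (A i t * B t k) * C k j))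
      ≈⟨ ∑-cong (λ t → trans (∑-cong (λ k → *-assoc _ _ _)) (sym (*-distribˡ-∑ (A i t) (λ k → B t k * C k j)))) ⟩
    ∑ (λ t → A i t * ∑ (λ k → B t k * C k j)) ∎

  mul-cong : ∀ {m} (A A' B B' : Matrix m) → (∀ i k → A i k ≈ A' i k) → (∀ i k → B i k ≈ B' i k) →
    ∀ i k → mul A B i k ≈ mul A' B' i k
  mul-cong A A' B B' e1 e2 i k = ∑-cong (λ t → *-cong (e1 i t) (e2 t k))

  -- det A is a unit because det B * det A = det (B A) = 1; hence det B times the adjugate of A
  -- is a right inverse of A, and it coincides with the left inverse B.
  leftInverse⇒rightInverse : ∀ {m} (A B : Matrix m) → (∀ i j → mul B A i j ≈ δ i j) → ∀ i j → mul A B i j ≈ δ i j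
  leftInverse⇒rightInverse {zero} A B h () j
  leftInverse⇒rightInverse {suc m} A B h i j = begin
    mul A B i j     ≈⟨ mul-cong A A B A⁻¹ (λ _ _ → refl) B≈A⁻¹ i j ⟩
    mul A A⁻¹ i j     ≈⟨ A*A⁻¹≈I i j ⟩
    δ i j ∎
    where
    detB : Carrier
    detB = det B
    detA*detB≈1 : det A * detB ≈ 1#
    detA*detB≈1 = trans (*-comm _ _) (trans (sym (det-mul B A)) (trans (det-cong _ _ h) (det-identity {suc m})))
    A⁻¹ : Matrix (suc m)
    A⁻¹ k j = detB * cofactor A j k
    A*A⁻¹≈I : ∀ i j → mul A A⁻¹ i j ≈ δ i j
    A*A⁻¹≈I i j = begin
      ∑ (λ k → A i k * (detB * cofactor A j k))  ≈⟨ ∑-cong (λ k → solve 3 (λ a detB c → (a :* (detB :* c)) := (detB :* (a :* c))) refl (A i k) detB (cofactor A j k)) ⟩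
      ∑ (λ k → detB * (A i k * cofactor A j k))  ≈⟨ sym (*-distribˡ-∑ detB (λ k → A i k * cofactor A j k)) ⟩
      detB * ∑ (λ k → A i k * cofactor A j k)    ≈⟨ *-congˡ (adjugate-identity A i j) ⟩
      detB * (δ i j * det A)               ≈⟨ solve 3 (λ detB d a → (detB :* (d :* a)) := (d :* (a :* detB))) refl detB (δ i j) (det A) ⟩
      δ i j * (det A * detB)               ≈⟨ *-congˡ detA*detB≈1 ⟩
      δ i j * 1#                        ≈⟨ *-identityʳ _ ⟩
      δ i j ∎
    B≈A⁻¹ : ∀ i j → B i j ≈ A⁻¹ i j
    B≈A⁻¹ i j = begin
      B i j  ≈⟨ sym (∑-*δ (B i) j) ⟩
      ∑ (λ k → B i k * δ k j)  ≈⟨ ∑-cong (λ k → *-congˡ (sym (A*A⁻¹≈I k j))) ⟩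
      mul B (mul A A⁻¹) i j      ≈⟨ sym (mul-assoc B A A⁻¹ i j) ⟩
      mul (mul B A) A⁻¹ i j      ≈⟨ mul-cong (mul B A) δ A⁻¹ A⁻¹ h (λ _ _ → refl) i j ⟩
      mul δ A⁻¹ i j              ≈⟨ ∑-δ* (λ t → A⁻¹ t j) i ⟩
      A⁻¹ i j ∎

module Restriction (K : InvolutiveCommRing) where

  open InvolutiveCommRing K hiding (zero)
  open IntegerCoefficients commRing
  open Determinant commRing public
  open import Algebra.Properties.Ring ring using (-‿distribˡ-*; -0#≈0#; x+x≈x⇒x≈0)
  open import Algebra.Properties.Group +-group using (inverseʳ-unique)
  open import Relation.Binary.Reasoning.Setoid setoid

  conj-0 : conj 0# ≈ 0#
  conj-0 = x+x≈x⇒x≈0 _ (sym (trans (conj-cong (sym (+-identityˡ 0#))) (conj-+ 0# 0#)))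

  conj-neg : ∀ a → conj (- a) ≈ - conj a
  conj-neg a = inverseʳ-unique (conj a) (conj (- a))
    (trans (sym (conj-+ a (- a))) (trans (conj-cong (-‿inverseʳ a)) conj-0))

  conj-fromℕ : ∀ m → conj (fromℕ m) ≈ fromℕ m
  conj-fromℕ zero = conj-0
  conj-fromℕ (suc m) = begin
    conj (fromℕ (suc m))          ≈⟨ conj-cong (fromℕ-suc m) ⟩
    conj (1# + fromℕ m)           ≈⟨ conj-+ 1# (fromℕ m) ⟩
    conj 1# + conj (fromℕ m)      ≈⟨ +-cong conj-1 (conj-fromℕ m) ⟩
    1# + fromℕ m                  ≈⟨ fromℕ-suc m ⟨
    fromℕ (suc m)                 ∎

  conj-fromℤ : ∀ z → conj (fromℤ z) ≈ fromℤ z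
  conj-fromℤ (+ m) = conj-fromℕ m
  conj-fromℤ -[1+ m ] = trans (conj-neg _) (-‿cong (conj-fromℕ (suc m)))

  conj-∑ : ∀ {m} (f : Fin m → Carrier) → conj (∑ f) ≈ ∑ (λ i → conj (f i))
  conj-∑ {zero} f = trans (conj-cong (reflexive (∑-zero f))) (trans conj-0 (sym (reflexive (∑-zero _))))
  conj-∑ {suc m} f = trans (conj-cong (reflexive (∑-suc f)))
    (trans (conj-+ _ _) (trans (+-congˡ (conj-∑ (λ i → f (suc i)))) (sym (reflexive (∑-suc _)))))

  ℕ→K≈fromℕ : ∀ m → ℕ→K K m ≈ fromℕ m
  ℕ→K≈fromℕ zero    = refl
  ℕ→K≈fromℕ (suc m) = trans (+-congˡ (ℕ→K≈fromℕ m)) (sym (fromℕ-suc m))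

  ℤ→K≈fromℤ : ∀ z → ℤ→K K z ≈ fromℤ z
  ℤ→K≈fromℤ (+ m)    = ℕ→K≈fromℕ m
  ℤ→K≈fromℤ -[1+ m ] = -‿cong (ℕ→K≈fromℕ (suc m))

  sumK≈∑ : ∀ {m} (f : Fin m → Carrier) → sumK K f ≈ ∑ f
  sumK≈∑ {zero} f = sym (reflexive (∑-zero f))
  sumK≈∑ {suc m} f = trans (+-congˡ (sumK≈∑ (λ i → f (suc i)))) (sym (reflexive (∑-suc f)))

  opaque
    ∑V : ∀ {n} → (Vertex n → Carrier) → Carrier
    ∑V f = ∑ (λ r → ∑ (λ i → f (r , i)))

  toVertex : ∀ {n} → Fin (n ℕ.* n) → Vertex n
  toVertex {n} p = remQuot n p

  δV : ∀ {n} → Vertex n → Vertex n → Carrier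
  δV (r , i) (s , j) = δ r s * δ i j

  δV-sym : ∀ {n} (v w : Vertex n) → δV v w ≈ δV w v
  δV-sym (r , i) (s , j) = reflexive (≡.cong₂ _*_ (δ-sym r s) (δ-sym i j))

  opaque
    unfolding ∑V

    ∑V-def : ∀ {n} (f : Vertex n → Carrier) → ∑V f ≡ ∑ (λ r → ∑ (λ i → f (r , i)))
    ∑V-def f = ≡.refl

    ∑V-split : ∀ {n'} (f : Vertex (suc n') → Carrier) →
      ∑V f ≈ ∑ (λ i → f (zero , i)) + ∑ (λ r → ∑ (λ i → f (suc r , i)))
    ∑V-split f = reflexive (∑-suc _)

    sumVK≈∑V : ∀ {n} (f : Vertex n → Carrier) → sumVK K f ≈ ∑V f
    sumVK≈∑V f = trans (sumK≈∑ _) (∑-cong (λ r → sumK≈∑ _))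

    ∑-toVertex : ∀ {n} (F : Vertex n → Carrier) → ∑ (λ p → F (toVertex {n} p)) ≈ ∑V F
    ∑-toVertex {n} F = trans (∑-combine n n _) (∑-cong (λ i → ∑-cong (λ j →
      reflexive (≡.cong F (remQuot-combine {n} {n} i j)))))

    ∑V-cong : ∀ {n} {f g : Vertex n → Carrier} → (∀ v → f v ≈ g v) → ∑V f ≈ ∑V g
    ∑V-cong e = ∑-cong (λ r → ∑-cong (λ i → e (r , i)))

    ∑V-distrib-+ : ∀ {n} (f g : Vertex n → Carrier) → ∑V (λ v → f v + g v) ≈ ∑V f + ∑V g
    ∑V-distrib-+ f g = trans (∑-cong (λ r → ∑-distrib-+ (λ i → f (r , i)) (λ i → g (r , i))))
                     (∑-distrib-+ (λ r → ∑ (λ i → f (r , i))) (λ r → ∑ (λ i → g (r , i))))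

    *-distribˡ-∑V : ∀ {n} (a : Carrier) (f : Vertex n → Carrier) → a * ∑V f ≈ ∑V (λ v → a * f v)
    *-distribˡ-∑V a f = trans (*-distribˡ-∑ a _) (∑-cong (λ r → *-distribˡ-∑ a (λ i → f (r , i))))

    *-distribʳ-∑V : ∀ {n} (a : Carrier) (f : Vertex n → Carrier) → ∑V f * a ≈ ∑V (λ v → f v * a)
    *-distribʳ-∑V a f = trans (*-comm _ _) (trans (*-distribˡ-∑V a f) (∑V-cong (λ v → *-comm a (f v))))

    -‿distrib-∑V : ∀ {n} (f : Vertex n → Carrier) → - ∑V f ≈ ∑V (λ v → - f v)
    -‿distrib-∑V f = trans (-‿distrib-∑ _) (∑-cong (λ r → -‿distrib-∑ (λ i → f (r , i))))

    ∑V-≈0 : ∀ {n} (f : Vertex n → Carrier) → (∀ v → f v ≈ 0#) → ∑V f ≈ 0#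
    ∑V-≈0 f e = ∑-≈0 _ (λ r → ∑-≈0 (λ i → f (r , i)) (λ i → e (r , i)))

    conj-∑V : ∀ {n} (f : Vertex n → Carrier) → conj (∑V f) ≈ ∑V (λ v → conj (f v))
    conj-∑V f = trans (conj-∑ _) (∑-cong (λ r → conj-∑ (λ i → f (r , i))))

    ∑V-∑-comm : ∀ {n m} (f : Vertex n → Fin m → Carrier) → ∑V (λ v → ∑ (λ t → f v t)) ≈ ∑ (λ t → ∑V (λ v → f v t))
    ∑V-∑-comm f = trans (∑-cong (λ r → ∑-comm (λ i t → f (r , i) t)))
                   (∑-comm (λ r t → ∑ (λ i → f (r , i) t)))

    ∑V-comm : ∀ {n} (f : Vertex n → Vertex n → Carrier) → ∑V (λ u → ∑V (λ v → f u v)) ≈ ∑V (λ v → ∑V (λ u → f u v))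
    ∑V-comm f = trans (∑V-∑-comm (λ u r → ∑ (λ i → f u (r , i))))
                      (∑-cong (λ r → ∑V-∑-comm (λ u i → f u (r , i))))

    ∑V-*δV : ∀ {n} (f : Vertex n → Carrier) (w : Vertex n) → ∑V (λ v → f v * δV v w) ≈ f w
    ∑V-*δV f (s , j) = begin
      ∑ (λ r → ∑ (λ i → f (r , i) * (δ r s * δ i j)))
        ≈⟨ ∑-cong (λ r → ∑-cong (λ i → solve 3 (λ a b c → (a :* (b :* c)) := ((a :* b) :* c)) refl (f (r , i)) (δ r s) (δ i j))) ⟩
      ∑ (λ r → ∑ (λ i → (f (r , i) * δ r s) * δ i j))
        ≈⟨ ∑-cong (λ r → ∑-*δ (λ i → f (r , i) * δ r s) j) ⟩
      ∑ (λ r → f (r , j) * δ r s)  ≈⟨ ∑-*δ (λ r → f (r , j)) s ⟩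
      f (s , j) ∎

    ∑V-*δV′ : ∀ {n} (f : Vertex n → Carrier) (v : Vertex n) → ∑V (λ w → f w * δV v w) ≈ f v
    ∑V-*δV′ f v = trans (∑V-cong (λ w → *-congˡ (δV-sym v w))) (∑V-*δV f v)

    ∑V-*-∑V : ∀ {n} (f g : Vertex n → Carrier) → ∑V f * ∑V g ≈ ∑V (λ u → ∑V (λ w → f u * g w))
    ∑V-*-∑V f g = trans (*-distribʳ-∑V (∑V g) f) (∑V-cong (λ u → *-distribˡ-∑V (f u) g))

  if-eqFin≈δ : ∀ {m} (k l : Fin m) → (if eqFin k l then 1# else 0#) ≈ δ k l
  if-eqFin≈δ k l with k ≟ l
  ... | yes ≡.refl = sym (δ-refl k)
  ... | no ne = sym (δ-≢ k l ne)

  δ-combine : ∀ {n} (r i s j : Fin n) → δ (combine {n} {n} r i) (combine {n} {n} s j) ≈ δV (r , i) (s , j)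
  δ-combine {n} r i s j with r ≟ s | i ≟ j
  ... | yes ≡.refl | yes ≡.refl = trans (δ-refl (combine {n} {n} r i)) (sym (trans (*-cong (δ-refl r) (δ-refl i)) (*-identityˡ _)))
  ... | yes ≡.refl | no ne = trans (δ-≢ _ _ (λ e → ne (≡.cong proj₂ (≡.trans (≡.sym (remQuot-combine {n} {n} r i))
                                    (≡.trans (≡.cong (remQuot n) e) (remQuot-combine {n} {n} s j))))))
                                  (sym (trans (*-congˡ (δ-≢ i j ne)) (zeroʳ _)))
  ... | no ne | _ = trans (δ-≢ _ _ (λ e → ne (≡.cong proj₁ (≡.trans (≡.sym (remQuot-combine {n} {n} r i))
                                    (≡.trans (≡.cong (remQuot n) e) (remQuot-combine {n} {n} s j))))))
                          (sym (trans (*-congʳ (δ-≢ r s ne)) (zeroˡ _)))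

  module Completeness (n' : ℕ) (x : Carrier) (N*x≈1′ : ℕ→K K (suc n' ℕ.* suc n') * x ≈ 1#)
    (Q : Vertex (suc n') → Fin (suc n' ℕ.* suc n' ℕ.∸ 1) → Carrier)
    (orthonormal : ∀ k l → sumVK K (λ w → conj (Q w k) * Q w l) ≈ (if eqFin k l then 1# else 0#))
    (Qᴴe≈0 : ∀ k → sumVK K (λ w → conj (Q w k)) ≈ 0#) where

    n : ℕ
    n = suc n'

    -- n * n ∸ 1, in the form for which suc M' reduces to n * n.
    M' : ℕ
    M' = n' ℕ.+ n' ℕ.* suc n'

    ∑V-Q≈0 : ∀ t → ∑V (λ v → Q v t) ≈ 0#
    ∑V-Q≈0 t = begin
      ∑V (λ v → Q v t)  ≈⟨ ∑V-cong (λ v → sym (conj-invol (Q v t))) ⟩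
      ∑V (λ v → conj (conj (Q v t)))  ≈⟨ sym (conj-∑V _) ⟩
      conj (∑V (λ v → conj (Q v t)))  ≈⟨ conj-cong (trans (sym (sumVK≈∑V _)) (Qᴴe≈0 t)) ⟩
      conj 0#  ≈⟨ conj-0 ⟩
      0# ∎

    -- Rows are indexed by vertices, columns by e and the columns of Q; by the restrictor
    -- conditions eQ⁺ is a left inverse of eQ, so it is also a right inverse, i.e. Q Qᴴ + x J = I.
    eQ : Matrix (suc M')
    eQ p zero = 1#
    eQ p (suc t) = Q (toVertex {n} p) t

    weight : Fin (suc M') → Carrier
    weight zero = x
    weight (suc t) = 1#

    eQ⁺ : Matrix (suc M')
    eQ⁺ c p = weight c * conj (eQ p c)

    N*x≈1 : fromℕ (suc M') * x ≈ 1#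
    N*x≈1 = trans (*-congʳ (sym (ℕ→K≈fromℕ (n ℕ.* n)))) N*x≈1′

    eQ⁺*eQ≈I : ∀ c c' → mul eQ⁺ eQ c c' ≈ δ c c'
    eQ⁺*eQ≈I zero zero = begin
      ∑ (λ p → (x * conj 1#) * 1#)  ≈⟨ ∑-cong (λ p → trans (*-identityʳ _) (trans (*-congˡ conj-1) (*-identityʳ _))) ⟩
      ∑ {suc M'} (λ p → x)  ≈⟨ ∑-const x ⟩
      fromℕ (suc M') * x  ≈⟨ N*x≈1 ⟩
      1# ∎
    eQ⁺*eQ≈I zero (suc t') = begin
      ∑ (λ p → (x * conj 1#) * Q (toVertex {n} p) t')
        ≈⟨ ∑-cong (λ p → *-congʳ (trans (*-congˡ conj-1) (*-identityʳ _))) ⟩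
      ∑ (λ p → x * Q (toVertex {n} p) t')  ≈⟨ sym (*-distribˡ-∑ x _) ⟩
      x * ∑ (λ p → Q (toVertex {n} p) t')  ≈⟨ *-congˡ (trans (∑-toVertex {n} (λ v → Q v t')) (∑V-Q≈0 t')) ⟩
      x * 0#  ≈⟨ zeroʳ x ⟩
      0# ∎
    eQ⁺*eQ≈I (suc t) zero = begin
      ∑ (λ p → (1# * conj (Q (toVertex {n} p) t)) * 1#)
        ≈⟨ ∑-cong (λ p → trans (*-identityʳ _) (*-identityˡ _)) ⟩
      ∑ (λ p → conj (Q (toVertex {n} p) t))  ≈⟨ ∑-toVertex {n} (λ v → conj (Q v t)) ⟩
      ∑V (λ v → conj (Q v t))  ≈⟨ trans (sym (sumVK≈∑V _)) (Qᴴe≈0 t) ⟩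
      0# ∎
    eQ⁺*eQ≈I (suc t) (suc t') = begin
      ∑ (λ p → (1# * conj (Q (toVertex {n} p) t)) * Q (toVertex {n} p) t')
        ≈⟨ ∑-cong (λ p → *-congʳ (*-identityˡ _)) ⟩
      ∑ (λ p → conj (Q (toVertex {n} p) t) * Q (toVertex {n} p) t')  ≈⟨ ∑-toVertex {n} (λ v → conj (Q v t) * Q v t') ⟩
      ∑V (λ v → conj (Q v t) * Q v t')  ≈⟨ trans (sym (sumVK≈∑V _)) (orthonormal t t') ⟩
      (if eqFin t t' then 1# else 0#)  ≈⟨ if-eqFin≈δ t t' ⟩
      δ t t' ∎

    eQ*eQ⁺≈I : ∀ p p' → mul eQ eQ⁺ p p' ≈ δ p p'
    eQ*eQ⁺≈I = leftInverse⇒rightInverse eQ eQ⁺ eQ⁺*eQ≈I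

    QQᴴ≈I-xJ′ : ∀ p p' → ∑ (λ t → Q (toVertex {n} p) t * conj (Q (toVertex {n} p') t)) ≈ δ p p' + - x
    QQᴴ≈I-xJ′ p p' = begin
      ∑ (λ t → Q (toVertex {n} p) t * conj (Q (toVertex {n} p') t))
        ≈⟨ solve 2 (λ a x → a := ((x :+ a) :+ (:- x))) refl _ x ⟩
      (x + ∑ (λ t → Q (toVertex {n} p) t * conj (Q (toVertex {n} p') t))) + - x
        ≈⟨ +-congʳ (+-cong (sym (trans (*-identityˡ _) (trans (*-congˡ conj-1) (*-identityʳ _))))
                           (∑-cong (λ t → *-congˡ (sym (*-identityˡ _))))) ⟩
      (1# * (x * conj 1#) + ∑ (λ t → Q (toVertex {n} p) t * (1# * conj (Q (toVertex {n} p') t)))) + - x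
        ≈⟨ +-congʳ (sym (reflexive (∑-suc _))) ⟩
      mul eQ eQ⁺ p p' + - x   ≈⟨ +-congʳ (eQ*eQ⁺≈I p p') ⟩
      δ p p' + - x ∎

    QQᴴ≈I-xJ : ∀ u v → ∑ (λ t → Q u t * conj (Q v t)) ≈ δV u v + - x
    QQᴴ≈I-xJ (r , i) (s , j) = begin
      ∑ (λ t → Q (r , i) t * conj (Q (s , j) t))
        ≈⟨ ∑-cong (λ t → *-cong (reflexive (≡.cong (λ w → Q w t) (≡.sym (remQuot-combine {n} {n} r i))))
                                (conj-cong (reflexive (≡.cong (λ w → Q w t) (≡.sym (remQuot-combine {n} {n} s j)))))) ⟩
      ∑ (λ t → Q (toVertex {n} (combine {n} {n} r i)) t * conj (Q (toVertex {n} (combine {n} {n} s j)) t))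
        ≈⟨ QQᴴ≈I-xJ′ (combine {n} {n} r i) (combine {n} {n} s j) ⟩
      δ (combine {n} {n} r i) (combine {n} {n} s j) + - x  ≈⟨ +-congʳ (δ-combine r i s j) ⟩
      δV (r , i) (s , j) + - x ∎

  rowGram : ∀ {n} → (Vertex n → Vertex n → Carrier) → Vertex n → Vertex n → Carrier
  rowGram L u u' = ∑V (λ v → L u v * L u' v)

  colGram : ∀ {n} → (Vertex n → Vertex n → Carrier) → Vertex n → Vertex n → Carrier
  colGram L u u' = ∑V (λ w → L w u * L w u')

  colSum : ∀ {n} → (Vertex n → Vertex n → Carrier) → Vertex n → Carrier
  colSum L u = ∑V (λ w → L w u)

  -- With a the conjugate of the k-th column of Q and b its l-th column, both summing to 0,
  -- and Q Qᴴ = I - x J, the (k , l) entries of (QᴴLQ)(QᴴLQ)ᴴ and (QᴴLQ)ᴴ(QᴴLQ) are the bilinear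
  -- forms of a and b against L Lᵀ (as L e = 0) and against Lᵀ L - x c cᵀ (c the column sums of L).
  -- Their difference is the form against L Lᵀ + x c cᵀ - Lᵀ L, which vanishes when that
  -- matrix is separable, i.e. of the shape g u + h u'.
  module NormalityCriterion {n m : ℕ} (x : Carrier) (Q : Vertex n → Fin m → Carrier) (L : Vertex n → Vertex n → Carrier)
    (QQᴴ≈I-xJ : ∀ u v → ∑ (λ t → Q u t * conj (Q v t)) ≈ δV u v + - x)
    (∑V-Qᴴ≈0 : ∀ k → ∑V (λ v → conj (Q v k)) ≈ 0#)
    (∑V-Q≈0 : ∀ k → ∑V (λ v → Q v k) ≈ 0#)
    (L-self-conjugate : ∀ u v → conj (L u v) ≈ L u v)
    (L-rowSum≈0 : ∀ u → ∑V (λ v → L u v) ≈ 0#)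
    (g h : Vertex n → Carrier)
    (separable : ∀ u u' → (rowGram L u u' + x * (colSum L u * colSum L u')) + - colGram L u u' ≈ g u + h u') where

    QᴴLQ : Fin m → Fin m → Carrier
    QᴴLQ k l = ∑V (λ u → ∑V (λ v → conj (Q u k) * (L u v * Q v l)))

    ∑V-a*L*q : ∀ (a q : Vertex n → Carrier) → ∑V (λ u → ∑V (λ v → a u * (L u v * q v))) ≈ ∑V (λ v → ∑V (λ u → a u * L u v) * q v)
    ∑V-a*L*q a q = trans (∑V-comm (λ u v → a u * (L u v * q v)))
                   (∑V-cong (λ v → trans (∑V-cong (λ u → sym (*-assoc _ _ _))) (sym (*-distribʳ-∑V (q v) (λ u → a u * L u v)))))

    ∑V-q*L*a : ∀ (a q : Vertex n → Carrier) → ∑V (λ u → ∑V (λ v → q u * (L u v * a v))) ≈ ∑V (λ u → ∑V (λ v → L u v * a v) * q u)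
    ∑V-q*L*a a q = ∑V-cong (λ u → trans (sym (*-distribˡ-∑V (q u) (λ v → L u v * a v))) (*-comm _ _))

    ∑-Q*Qᴴ : ∀ (p q : Vertex n → Carrier) →
      ∑ (λ t → ∑V (λ v → p v * Q v t) * ∑V (λ w → q w * conj (Q w t)))
        ≈ ∑V (λ v → p v * q v) + - (x * (∑V p * ∑V q))
    ∑-Q*Qᴴ p q = begin
      ∑ (λ t → ∑V (λ v → p v * Q v t) * ∑V (λ w → q w * conj (Q w t)))
        ≈⟨ ∑-cong (λ t → ∑V-*-∑V (λ v → p v * Q v t) (λ w → q w * conj (Q w t))) ⟩
      ∑ (λ t → ∑V (λ v → ∑V (λ w → (p v * Q v t) * (q w * conj (Q w t)))))
        ≈⟨ sym (∑V-∑-comm (λ v t → ∑V (λ w → (p v * Q v t) * (q w * conj (Q w t))))) ⟩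
      ∑V (λ v → ∑ (λ t → ∑V (λ w → (p v * Q v t) * (q w * conj (Q w t)))))
        ≈⟨ ∑V-cong (λ v → sym (∑V-∑-comm (λ w t → (p v * Q v t) * (q w * conj (Q w t))))) ⟩
      ∑V (λ v → ∑V (λ w → ∑ (λ t → (p v * Q v t) * (q w * conj (Q w t)))))
        ≈⟨ ∑V-cong (λ v → ∑V-cong (λ w → trans (∑-cong (λ t → regroup (p v) (q w) (Q v t) (conj (Q w t))))
              (sym (*-distribˡ-∑ (p v * q w) (λ t → Q v t * conj (Q w t)))))) ⟩
      ∑V (λ v → ∑V (λ w → (p v * q w) * ∑ (λ t → Q v t * conj (Q w t))))
        ≈⟨ ∑V-cong (λ v → ∑V-cong (λ w → trans (*-congˡ (QQᴴ≈I-xJ v w)) (distribˡ _ _ _))) ⟩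
      ∑V (λ v → ∑V (λ w → (p v * q w) * δV v w + (p v * q w) * - x))
        ≈⟨ ∑V-cong (λ v → ∑V-distrib-+ (λ w → (p v * q w) * δV v w) (λ w → (p v * q w) * - x)) ⟩
      ∑V (λ v → ∑V (λ w → (p v * q w) * δV v w) + ∑V (λ w → (p v * q w) * - x))
        ≈⟨ ∑V-distrib-+ (λ v → ∑V (λ w → (p v * q w) * δV v w)) (λ v → ∑V (λ w → (p v * q w) * - x)) ⟩
      ∑V (λ v → ∑V (λ w → (p v * q w) * δV v w)) + ∑V (λ v → ∑V (λ w → (p v * q w) * - x))
        ≈⟨ +-cong (∑V-cong (λ v → ∑V-*δV′ (λ w → p v * q w) v)) J-part ⟩
      ∑V (λ v → p v * q v) + - (x * (∑V p * ∑V q)) ∎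
      where
      regroup : ∀ a b c d → (a * c) * (b * d) ≈ (a * b) * (c * d)
      regroup = solve 4 (λ a b c d → ((a :* c) :* (b :* d)) := ((a :* b) :* (c :* d))) refl
      J-part : ∑V (λ v → ∑V (λ w → (p v * q w) * - x)) ≈ - (x * (∑V p * ∑V q))
      J-part = begin
        ∑V (λ v → ∑V (λ w → (p v * q w) * - x))
          ≈⟨ ∑V-cong (λ v → ∑V-cong (λ w → solve 3 (λ a b x → ((a :* b) :* (:- x)) := ((:- x) :* (a :* b))) refl (p v) (q w) x)) ⟩
        ∑V (λ v → ∑V (λ w → (- x) * (p v * q w)))
          ≈⟨ ∑V-cong (λ v → sym (*-distribˡ-∑V (- x) (λ w → p v * q w))) ⟩
        ∑V (λ v → (- x) * ∑V (λ w → p v * q w))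
          ≈⟨ sym (*-distribˡ-∑V (- x) (λ v → ∑V (λ w → p v * q w))) ⟩
        (- x) * ∑V (λ v → ∑V (λ w → p v * q w))
          ≈⟨ *-congˡ (sym (∑V-*-∑V p q)) ⟩
        (- x) * (∑V p * ∑V q)  ≈⟨ sym (-‿distribˡ-* _ _) ⟩
        - (x * (∑V p * ∑V q)) ∎

    form : (a b : Vertex n → Carrier) (F : Vertex n → Vertex n → Carrier) → Carrier
    form a b F = ∑V (λ u → ∑V (λ u' → a u * (b u' * F u u')))

    ∑-products≈form : ∀ (M1 M2 : Vertex n → Vertex n → Carrier) (a b : Vertex n → Carrier) →
      ∑V (λ w → ∑V (λ u → M1 w u * a u) * ∑V (λ u' → M2 w u' * b u'))
        ≈ form a b (λ u u' → ∑V (λ w → M1 w u * M2 w u'))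
    ∑-products≈form M1 M2 a b = begin
      ∑V (λ w → ∑V (λ u → M1 w u * a u) * ∑V (λ u' → M2 w u' * b u'))
        ≈⟨ ∑V-cong (λ w → ∑V-*-∑V (λ u → M1 w u * a u) (λ u' → M2 w u' * b u')) ⟩
      ∑V (λ w → ∑V (λ u → ∑V (λ u' → (M1 w u * a u) * (M2 w u' * b u'))))
        ≈⟨ ∑V-comm (λ w u → ∑V (λ u' → (M1 w u * a u) * (M2 w u' * b u'))) ⟩
      ∑V (λ u → ∑V (λ w → ∑V (λ u' → (M1 w u * a u) * (M2 w u' * b u'))))
        ≈⟨ ∑V-cong (λ u → ∑V-comm (λ w u' → (M1 w u * a u) * (M2 w u' * b u'))) ⟩
      ∑V (λ u → ∑V (λ u' → ∑V (λ w → (M1 w u * a u) * (M2 w u' * b u'))))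
        ≈⟨ ∑V-cong (λ u → ∑V-cong (λ u' → trans (∑V-cong (λ w →
              solve 4 (λ p a q b → ((p :* a) :* (q :* b)) := ((a :* b) :* (p :* q))) refl (M1 w u) (a u) (M2 w u') (b u')))
              (trans (sym (*-distribˡ-∑V (a u * b u') (λ w → M1 w u * M2 w u'))) (*-assoc _ _ _)))) ⟩
      form a b (λ u u' → ∑V (λ w → M1 w u * M2 w u')) ∎

    form-separable≈0 : ∀ (a b : Vertex n → Carrier) (F : Vertex n → Vertex n → Carrier) (g h : Vertex n → Carrier) →
      (∀ u u' → F u u' ≈ g u + h u') → ∑V a ≈ 0# → ∑V b ≈ 0# → form a b F ≈ 0#
    form-separable≈0 a b F g h e za zb = begin
      ∑V (λ u → ∑V (λ u' → a u * (b u' * F u u')))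
        ≈⟨ ∑V-cong (λ u → ∑V-cong (λ u' → trans (*-congˡ (*-congˡ (e u u')))
              (solve 5 (λ a b g h d → (a :* (b :* (g :+ h))) := (((a :* g) :* b) :+ (a :* (b :* h)))) refl (a u) (b u') (g u) (h u') 0#))) ⟩
      ∑V (λ u → ∑V (λ u' → (a u * g u) * b u' + a u * (b u' * h u')))
        ≈⟨ ∑V-cong (λ u → trans (∑V-distrib-+ (λ u' → (a u * g u) * b u') (λ u' → a u * (b u' * h u')))
              (+-cong (sym (*-distribˡ-∑V (a u * g u) b)) (sym (*-distribˡ-∑V (a u) (λ u' → b u' * h u'))))) ⟩
      ∑V (λ u → (a u * g u) * ∑V b + a u * ∑V (λ u' → b u' * h u'))
        ≈⟨ ∑V-cong (λ u → trans (+-congʳ (trans (*-congˡ zb) (zeroʳ _))) (+-identityˡ _)) ⟩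
      ∑V (λ u → a u * ∑V (λ u' → b u' * h u'))
        ≈⟨ sym (*-distribʳ-∑V (∑V (λ u' → b u' * h u')) a) ⟩
      ∑V a * ∑V (λ u' → b u' * h u')  ≈⟨ trans (*-congʳ za) (zeroˡ _) ⟩
      0# ∎

    form-+ : ∀ a b F F' → form a b (λ u u' → F u u' + F' u u') ≈ form a b F + form a b F'
    form-+ a b F F' = trans (∑V-cong (λ u → trans (∑V-cong (λ u' → trans (*-congˡ (distribˡ _ _ _)) (distribˡ _ _ _)))
                            (∑V-distrib-+ (λ u' → a u * (b u' * F u u')) (λ u' → a u * (b u' * F' u u')))))
                         (∑V-distrib-+ _ _)

    form-* : ∀ a b s F → form a b (λ u u' → s * F u u') ≈ s * form a b F
    form-* a b s F = trans (∑V-cong (λ u → trans (∑V-cong (λ u' →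
                    solve 4 (λ a b s f → (a :* (b :* (s :* f))) := (s :* (a :* (b :* f)))) refl (a u) (b u') s (F u u')))
                    (sym (*-distribˡ-∑V s (λ u' → a u * (b u' * F u u'))))))
                  (sym (*-distribˡ-∑V s _))

    form-neg : ∀ a b F → form a b (λ u u' → - F u u') ≈ - form a b F
    form-neg a b F = trans (∑V-cong (λ u → trans (∑V-cong (λ u' →
                    solve 3 (λ a b f → (a :* (b :* (:- f))) := (:- (a :* (b :* f)))) refl (a u) (b u') (F u u')))
                    (sym (-‿distrib-∑V (λ u' → a u * (b u' * F u u'))))))
                  (sym (-‿distrib-∑V _))

    normal : ∀ k l → ∑ (λ t → QᴴLQ k t * conj (QᴴLQ l t)) ≈ ∑ (λ t → conj (QᴴLQ t k) * QᴴLQ t l)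
    normal k l = begin
      ∑ (λ t → QᴴLQ k t * conj (QᴴLQ l t))
        ≈⟨ ∑-cong (λ t → *-cong (∑V-a*L*q a (λ v → Q v t)) (cX t)) ⟩
      ∑ (λ t → ∑V (λ v → α v * Q v t) * ∑V (λ w → β w * conj (Q w t)))
        ≈⟨ ∑-Q*Qᴴ α β ⟩
      ∑V (λ v → α v * β v) + - (x * (∑V α * ∑V β))
        ≈⟨ trans (+-congˡ (trans (-‿cong (trans (*-congˡ (trans (*-congʳ Σα) (zeroˡ _))) (zeroʳ _))) -0#≈0#)) (+-identityʳ _) ⟩
      ∑V (λ v → α v * β v)
        ≈⟨ trans (∑V-cong (λ v → *-cong (∑V-cong (λ u → *-comm _ _)) (∑V-cong (λ u → *-comm _ _))))
                 (∑-products≈form (λ w u → L u w) (λ w u → L u w) a b) ⟩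
      form a b (rowGram L)  ≈⟨ key ⟩
      form a b (colGram L) + - (x * form a b (λ u u' → colSum L u * colSum L u'))
        ≈⟨ sym (+-cong (∑-products≈form L L a b) (-‿cong (*-congˡ (trans (*-cong (sL a) (sL b))
               (trans (∑V-*-∑V (λ u → colSum L u * a u) (λ u → colSum L u * b u))
                      (∑V-cong (λ u → ∑V-cong (λ u' → solve 4 (λ c a d b → ((c :* a) :* (d :* b)) := (a :* (b :* (c :* d)))) refl
                           (colSum L u) (a u) (colSum L u') (b u'))))))))) ⟩
      ∑V (λ w → La w * Lb w) + - (x * (∑V La * ∑V Lb))
        ≈⟨ sym (∑-Q*Qᴴ La Lb) ⟩
      ∑ (λ t → ∑V (λ u → La u * Q u t) * ∑V (λ w → Lb w * conj (Q w t)))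
        ≈⟨ sym (∑-cong (λ t → *-cong (cXk t) (∑V-q*L*a b (λ u → conj (Q u t))))) ⟩
      ∑ (λ t → conj (QᴴLQ t k) * QᴴLQ t l) ∎
      where
      a b α β La Lb : Vertex n → Carrier
      a u = conj (Q u k)
      b u = Q u l
      α v = ∑V (λ u → a u * L u v)
      β v = ∑V (λ u → b u * L u v)
      La u = ∑V (λ v → L u v * a v)
      Lb u = ∑V (λ v → L u v * b v)
      za : ∑V a ≈ 0#
      za = ∑V-Qᴴ≈0 k
      zb : ∑V b ≈ 0#
      zb = ∑V-Q≈0 l
      cX : ∀ t → conj (QᴴLQ l t) ≈ ∑V (λ v → β v * conj (Q v t))
      cX t = begin
        conj (QᴴLQ l t)  ≈⟨ trans (conj-∑V _) (∑V-cong (λ u → conj-∑V _)) ⟩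
        ∑V (λ u → ∑V (λ v → conj (conj (Q u l) * (L u v * Q v t))))
          ≈⟨ ∑V-cong (λ u → ∑V-cong (λ v → trans (conj-* _ _) (*-cong (conj-invol _)
                (trans (conj-* _ _) (*-congʳ (L-self-conjugate u v)))))) ⟩
        ∑V (λ u → ∑V (λ v → b u * (L u v * conj (Q v t))))  ≈⟨ ∑V-a*L*q b (λ v → conj (Q v t)) ⟩
        ∑V (λ v → β v * conj (Q v t)) ∎
      cXk : ∀ t → conj (QᴴLQ t k) ≈ ∑V (λ u → La u * Q u t)
      cXk t = begin
        conj (QᴴLQ t k)  ≈⟨ trans (conj-∑V _) (∑V-cong (λ u → conj-∑V _)) ⟩
        ∑V (λ u → ∑V (λ v → conj (conj (Q u t) * (L u v * Q v k))))
          ≈⟨ ∑V-cong (λ u → ∑V-cong (λ v → trans (conj-* _ _) (*-cong (conj-invol _)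
                (trans (conj-* _ _) (*-congʳ (L-self-conjugate u v)))))) ⟩
        ∑V (λ u → ∑V (λ v → Q u t * (L u v * a v)))  ≈⟨ ∑V-q*L*a a (λ u → Q u t) ⟩
        ∑V (λ u → La u * Q u t) ∎
      Σα : ∑V α ≈ 0#
      Σα = begin
        ∑V (λ v → ∑V (λ u → a u * L u v))  ≈⟨ ∑V-comm (λ v u → a u * L u v) ⟩
        ∑V (λ u → ∑V (λ v → a u * L u v))  ≈⟨ ∑V-cong (λ u → trans (sym (*-distribˡ-∑V (a u) (L u))) (trans (*-congˡ (L-rowSum≈0 u)) (zeroʳ _))) ⟩
        ∑V (λ u → 0#)  ≈⟨ ∑V-≈0 (λ _ → 0#) (λ _ → refl) ⟩
        0# ∎
      sL : ∀ (c : Vertex n → Carrier) → ∑V (λ u → ∑V (λ v → L u v * c v)) ≈ ∑V (λ v → colSum L v * c v)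
      sL c = trans (∑V-comm (λ u v → L u v * c v)) (∑V-cong (λ v → sym (*-distribʳ-∑V (c v) (λ u → L u v))))
      key : form a b (rowGram L) ≈ form a b (colGram L) + - (x * form a b (λ u u' → colSum L u * colSum L u'))
      key = begin
        form a b (rowGram L)  ≈⟨ solve 3 (λ A B C → A := (((A :+ C) :+ (:- B)) :+ (B :+ (:- C)))) refl _ (form a b (colGram L)) (x * form a b (λ u u' → colSum L u * colSum L u')) ⟩
        ((form a b (rowGram L) + x * form a b (λ u u' → colSum L u * colSum L u')) + - form a b (colGram L))
          + (form a b (colGram L) + - (x * form a b (λ u u' → colSum L u * colSum L u')))
          ≈⟨ +-congʳ (trans (sym lin) zero') ⟩
        0# + (form a b (colGram L) + - (x * form a b (λ u u' → colSum L u * colSum L u')))  ≈⟨ +-identityˡ _ ⟩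
        form a b (colGram L) + - (x * form a b (λ u u' → colSum L u * colSum L u')) ∎
        where
        W : Vertex n → Vertex n → Carrier
        W u u' = (rowGram L u u' + x * (colSum L u * colSum L u')) + - colGram L u u'
        zero' : form a b W ≈ 0#
        zero' = form-separable≈0 a b W g h separable za zb
        lin : form a b W ≈ (form a b (rowGram L) + x * form a b (λ u u' → colSum L u * colSum L u')) + - form a b (colGram L)
        lin = trans (form-+ a b (λ u u' → rowGram L u u' + x * (colSum L u * colSum L u')) (λ u u' → - colGram L u u'))
                (+-cong (trans (form-+ a b (rowGram L) (λ u u' → x * (colSum L u * colSum L u')))
                               (+-congˡ (form-* a b x (λ u u' → colSum L u * colSum L u'))))
                        (form-neg a b (colGram L)))
  Separable : ∀ {n} → (Vertex n → Vertex n → Carrier) → Set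
  Separable {n} W = Σ (Vertex n → Carrier) λ g → Σ (Vertex n → Carrier) λ h → ∀ u u' → W u u' ≈ g u + h u'

  restriction-normal : ∀ n' (M : Vertex (suc n') → Vertex (suc n') → ℤ) →
    let n = suc n'
        L = λ u v → ℤ→K K (M u v)
    in (∀ u → ∑V (L u) ≈ 0#) →
       (∀ x → ℕ→K K (n ℕ.* n) * x ≈ 1# →
          Separable (λ u u' → (rowGram L u u' + x * (colSum L u * colSum L u')) - colGram L u u')) →
       Σ Carrier (λ x → ℕ→K K (n ℕ.* n) * x ≈ 1#) →
       (Q : Vertex n → Fin (n ℕ.* n ℕ.∸ 1) → Carrier) → IsRestrictor K n Q →
       IsNormalK K (restrictL K n Q M)
  restriction-normal n' M L-rowSum≈0 separable (x , N*x≈1) Q (orthonormal , Qᴴe≈0) k l = begin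
    sumK K (λ t → QᴴMQ k t * conj (QᴴMQ l t))   ≈⟨ sumK≈∑ _ ⟩
    ∑ (λ t → QᴴMQ k t * conj (QᴴMQ l t))        ≈⟨ ∑-cong (λ t → *-cong (QᴴMQ≈ k t) (conj-cong (QᴴMQ≈ l t))) ⟩
    ∑ (λ t → QᴴLQ k t * conj (QᴴLQ l t))        ≈⟨ normal k l ⟩
    ∑ (λ t → conj (QᴴLQ t k) * QᴴLQ t l)        ≈⟨ ∑-cong (λ t → *-cong (conj-cong (QᴴMQ≈ t k)) (QᴴMQ≈ t l)) ⟨
    ∑ (λ t → conj (QᴴMQ t k) * QᴴMQ t l)        ≈⟨ sumK≈∑ _ ⟨
    sumK K (λ t → conj (QᴴMQ t k) * QᴴMQ t l)   ∎
    where
    L : Vertex (suc n') → Vertex (suc n') → Carrier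
    L u v = ℤ→K K (M u v)
    QᴴMQ : Fin (suc n' ℕ.* suc n' ℕ.∸ 1) → Fin (suc n' ℕ.* suc n' ℕ.∸ 1) → Carrier
    QᴴMQ = restrictL K (suc n') Q M
    L-self-conjugate : ∀ u v → conj (L u v) ≈ L u v
    L-self-conjugate u v = trans (conj-cong (ℤ→K≈fromℤ (M u v))) (trans (conj-fromℤ (M u v)) (sym (ℤ→K≈fromℤ (M u v))))
    ∑V-Qᴴ≈0 : ∀ k → ∑V (λ v → conj (Q v k)) ≈ 0#
    ∑V-Qᴴ≈0 k = trans (sym (sumVK≈∑V _)) (Qᴴe≈0 k)
    open Completeness n' x N*x≈1 Q orthonormal Qᴴe≈0 using (QQᴴ≈I-xJ; ∑V-Q≈0)
    open NormalityCriterion x Q L QQᴴ≈I-xJ ∑V-Qᴴ≈0 ∑V-Q≈0 L-self-conjugate L-rowSum≈0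
      (proj₁ (separable x N*x≈1)) (proj₁ (proj₂ (separable x N*x≈1))) (proj₂ (proj₂ (separable x N*x≈1)))
    QᴴMQ≈ : ∀ k l → QᴴMQ k l ≈ QᴴLQ k l
    QᴴMQ≈ k l = trans (sumVK≈∑V _) (∑V-cong (λ u → sumVK≈∑V _))

module DigraphΓ (K : InvolutiveCommRing) where

  open InvolutiveCommRing K hiding (zero)
  open IntegerCoefficients commRing
  open Restriction K
  open import Algebra.Properties.Ring ring using (-‿involutive; -0#≈0#)
  open import Relation.Binary.Reasoning.Setoid setoid

  ∑-0# : ∀ {k} → ∑ {k} (λ _ → 0#) ≈ 0#
  ∑-0# = ∑-≈0 _ (λ _ → refl)

  fromℕ-sumℕ : ∀ {k} (f : Fin k → ℕ) → fromℕ (sumℕ f) ≈ ∑ (λ i → fromℕ (f i))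
  fromℕ-sumℕ {zero} f = sym (reflexive (∑-zero _))
  fromℕ-sumℕ {suc k} f = trans (fromℕ-+ (f zero) _) (trans (+-congˡ (fromℕ-sumℕ (λ i → f (suc i)))) (sym (reflexive (∑-suc _))))

  b2n-eqFin≈δ : ∀ {k} (i j : Fin k) → fromℕ (b2n (eqFin i j)) ≈ δ i j
  b2n-eqFin≈δ i j with i ≟ j
  ... | yes ≡.refl = sym (δ-refl i)
  ... | no ne = sym (δ-≢ i j ne)

  δᶜ : ∀ {k} → Fin k → Fin k → Carrier
  δᶜ i j = 1# + - δ i j

  b2n-not-eqFin≈δᶜ : ∀ {k} (i j : Fin k) → fromℕ (b2n (not (eqFin i j))) ≈ δᶜ i j
  b2n-not-eqFin≈δᶜ i j with i ≟ j
  ... | yes ≡.refl = sym (trans (+-congˡ (-‿cong (δ-refl i))) (-‿inverseʳ 1#))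
  ... | no ne = sym (trans (+-congˡ (trans (-‿cong (δ-≢ i j ne)) -0#≈0#)) (+-identityʳ 1#))

  module Adjacency (n' : ℕ) where
    n : ℕ
    n = suc n'

    m : Carrier
    m = fromℕ n'

    A : Vertex n → Vertex n → Carrier
    A u v = fromℕ (b2n (adjΓ n u v))

    A-0s : ∀ i s j → A (zero , i) (suc s , j) ≈ δ i j
    A-0s i s j = b2n-eqFin≈δ i j
    A-s0 : ∀ r i j → A (suc r , i) (zero , j) ≈ δᶜ i j
    A-s0 r i j = b2n-not-eqFin≈δᶜ i j

    ∑-1# : ∑ {n} (λ _ → 1#) ≈ 1# + m
    ∑-1# = trans (∑-const 1#) (trans (*-identityʳ _) (fromℕ-suc n'))
    ∑-δ-row : ∀ i → ∑ {n} (λ j → δ i j) ≈ 1#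
    ∑-δ-row i = trans (∑-cong (λ j → sym (*-identityʳ _))) (∑-δ* (λ _ → 1#) i)
    ∑-δ-col : ∀ j → ∑ {n} (λ i → δ i j) ≈ 1#
    ∑-δ-col j = trans (∑-cong (λ i → sym (*-identityˡ _))) (∑-*δ (λ _ → 1#) j)
    ∑-δᶜ-row : ∀ i → ∑ {n} (λ j → δᶜ i j) ≈ m
    ∑-δᶜ-row i = begin
      ∑ (λ j → 1# + - δ i j)  ≈⟨ ∑-distrib-+ (λ _ → 1#) (λ j → - δ i j) ⟩
      ∑ {n} (λ _ → 1#) + ∑ (λ j → - δ i j)  ≈⟨ +-cong ∑-1# (trans (sym (-‿distrib-∑ (δ i))) (-‿cong (∑-δ-row i))) ⟩
      (1# + m) + - 1#  ≈⟨ solve 1 (λ m → ((con (+ 1) :+ m) :+ (:- con (+ 1))) := m) refl m ⟩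
      m ∎
    ∑-δᶜ-col : ∀ j → ∑ {n} (λ i → δᶜ i j) ≈ m
    ∑-δᶜ-col j = trans (∑-cong (λ i → +-congˡ (-‿cong (reflexive (δ-sym i j))))) (∑-δᶜ-row j)
    ∑-δδ-row : ∀ i i' → ∑ {n} (λ j → δ i j * δ i' j) ≈ δ i i'
    ∑-δδ-row i i' = trans (∑-cong (λ j → *-congˡ (reflexive (δ-sym i' j)))) (∑-*δ (δ i) i')
    ∑-δδ-col : ∀ i i' → ∑ {n} (λ k → δ k i * δ k i') ≈ δ i i'
    ∑-δδ-col i i' = trans (∑-cong (λ k → reflexive (≡.cong₂ _*_ (δ-sym k i) (δ-sym k i')))) (∑-δδ-row i i')
    ∑-δᶜδᶜ-row : ∀ i i' → ∑ {n} (λ j → δᶜ i j * δᶜ i' j) ≈ (m + - 1#) + δ i i'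
    ∑-δᶜδᶜ-row i i' = begin
      ∑ (λ j → δᶜ i j * δᶜ i' j)
        ≈⟨ ∑-cong (λ j → solve 2 (λ a b → (((con (+ 1)) :+ (:- a)) :* ((con (+ 1)) :+ (:- b))) := ((con (+ 1) :+ ((:- a) :+ (:- b))) :+ (a :* b))) refl (δ i j) (δ i' j)) ⟩
      ∑ (λ j → (1# + (- δ i j + - δ i' j)) + δ i j * δ i' j)
        ≈⟨ trans (∑-distrib-+ _ _) (+-congʳ (trans (∑-distrib-+ _ _) (+-congˡ (∑-distrib-+ _ _)))) ⟩
      (∑ {n} (λ _ → 1#) + (∑ (λ j → - δ i j) + ∑ (λ j → - δ i' j))) + ∑ (λ j → δ i j * δ i' j)
        ≈⟨ +-cong (+-cong ∑-1# (+-cong (trans (sym (-‿distrib-∑ (δ i))) (-‿cong (∑-δ-row i))) (trans (sym (-‿distrib-∑ (δ i'))) (-‿cong (∑-δ-row i'))))) (∑-δδ-row i i') ⟩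
      ((1# + m) + (- 1# + - 1#)) + δ i i'
        ≈⟨ +-congʳ (solve 1 (λ m → ((con (+ 1) :+ m) :+ ((:- con (+ 1)) :+ (:- con (+ 1)))) := (m :+ (:- con (+ 1)))) refl m) ⟩
      (m + - 1#) + δ i i' ∎
    ∑-δᶜδᶜ-col : ∀ i i' → ∑ {n} (λ k → δᶜ k i * δᶜ k i') ≈ (m + - 1#) + δ i i'
    ∑-δᶜδᶜ-col i i' = trans (∑-cong (λ k → *-cong (+-congˡ (-‿cong (reflexive (δ-sym k i)))) (+-congˡ (-‿cong (reflexive (δ-sym k i'))))))
                  (∑-δᶜδᶜ-row i i')

    A-rowSum : ∀ u → ∑V (A u) ≈ m
    A-rowSum (zero , i) = begin
      ∑V (A (zero , i))  ≈⟨ ∑V-split _ ⟩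
      ∑ {n} (λ j → 0#) + ∑ (λ r → ∑ (λ j → A (zero , i) (suc r , j)))
        ≈⟨ +-cong ∑-0# (∑-cong (λ r → trans (∑-cong (λ j → A-0s i r j)) (∑-δ-row i))) ⟩
      0# + ∑ {n'} (λ _ → 1#)  ≈⟨ trans (+-identityˡ _) (trans (∑-const 1#) (*-identityʳ _)) ⟩
      m ∎
    A-rowSum (suc r , i) = begin
      ∑V (A (suc r , i))  ≈⟨ ∑V-split _ ⟩
      ∑ (λ j → A (suc r , i) (zero , j)) + ∑ {n'} (λ s → ∑ {n} (λ j → 0#))
        ≈⟨ +-cong (trans (∑-cong (λ j → A-s0 r i j)) (∑-δᶜ-row i)) (trans (∑-cong (λ _ → ∑-0#)) ∑-0#) ⟩
      m + 0#  ≈⟨ +-identityʳ _ ⟩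
      m ∎

    inDegree : Vertex n → Carrier
    inDegree (zero , _) = m * m
    inDegree (suc _ , _) = 1#

    A-colSum : ∀ u → ∑V (λ w → A w u) ≈ inDegree u
    A-colSum (zero , j) = begin
      ∑V (λ w → A w (zero , j))  ≈⟨ ∑V-split _ ⟩
      ∑ {n} (λ i → 0#) + ∑ (λ r → ∑ (λ i → A (suc r , i) (zero , j)))
        ≈⟨ +-cong ∑-0# (∑-cong (λ r → trans (∑-cong (λ i → A-s0 r i j)) (∑-δᶜ-col j))) ⟩
      0# + ∑ {n'} (λ _ → m)  ≈⟨ trans (+-identityˡ _) (∑-const m) ⟩
      m * m ∎
    A-colSum (suc s , j) = begin
      ∑V (λ w → A w (suc s , j))  ≈⟨ ∑V-split _ ⟩
      ∑ (λ i → A (zero , i) (suc s , j)) + ∑ {n'} (λ r → ∑ {n} (λ i → 0#))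
        ≈⟨ +-cong (trans (∑-cong (λ i → A-0s i s j)) (∑-δ-col j)) (trans (∑-cong (λ _ → ∑-0#)) ∑-0#) ⟩
      1# + 0#  ≈⟨ +-identityʳ _ ⟩
      1# ∎

    AAᵀ AᵀA : Vertex n → Vertex n → Carrier
    AAᵀ u u' = ∑V (λ w → A u w * A u' w)
    AᵀA u u' = ∑V (λ w → A w u * A w u')

    ∑-0#*0# : ∀ {k} → ∑ {k} (λ _ → 0# * 0#) ≈ 0#
    ∑-0#*0# = trans (∑-cong (λ _ → zeroˡ 0#)) ∑-0#

    AAᵀ-00 : ∀ i i' → AAᵀ (zero , i) (zero , i') ≈ m * δ i i'
    AAᵀ-00 i i' = begin
      AAᵀ (zero , i) (zero , i')  ≈⟨ ∑V-split _ ⟩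
      ∑ {n} (λ j → 0# * 0#) + ∑ (λ r → ∑ (λ j → A (zero , i) (suc r , j) * A (zero , i') (suc r , j)))
        ≈⟨ +-cong ∑-0#*0# (∑-cong (λ r → trans (∑-cong (λ j → *-cong (A-0s i r j) (A-0s i' r j))) (∑-δδ-row i i'))) ⟩
      0# + ∑ {n'} (λ _ → δ i i')  ≈⟨ trans (+-identityˡ _) (∑-const _) ⟩
      m * δ i i' ∎
    AAᵀ-0s : ∀ i r' i' → AAᵀ (zero , i) (suc r' , i') ≈ 0#
    AAᵀ-0s i r' i' = begin
      AAᵀ (zero , i) (suc r' , i')  ≈⟨ ∑V-split _ ⟩
      ∑ {n} (λ j → 0# * A (suc r' , i') (zero , j)) + ∑ {n'} (λ r → ∑ {n} (λ j → A (zero , i) (suc r , j) * 0#))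
        ≈⟨ +-cong (trans (∑-cong (λ j → zeroˡ _)) ∑-0#) (trans (∑-cong (λ r → trans (∑-cong (λ j → zeroʳ _)) ∑-0#)) ∑-0#) ⟩
      0# + 0#  ≈⟨ +-identityʳ _ ⟩
      0# ∎
    AAᵀ-s0 : ∀ r i i' → AAᵀ (suc r , i) (zero , i') ≈ 0#
    AAᵀ-s0 r i i' = begin
      AAᵀ (suc r , i) (zero , i')  ≈⟨ ∑V-split _ ⟩
      ∑ {n} (λ j → A (suc r , i) (zero , j) * 0#) + ∑ {n'} (λ s → ∑ {n} (λ j → 0# * A (zero , i') (suc s , j)))
        ≈⟨ +-cong (trans (∑-cong (λ j → zeroʳ _)) ∑-0#) (trans (∑-cong (λ s → trans (∑-cong (λ j → zeroˡ _)) ∑-0#)) ∑-0#) ⟩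
      0# + 0#  ≈⟨ +-identityʳ _ ⟩
      0# ∎
    AAᵀ-ss : ∀ r i r' i' → AAᵀ (suc r , i) (suc r' , i') ≈ (m + - 1#) + δ i i'
    AAᵀ-ss r i r' i' = begin
      AAᵀ (suc r , i) (suc r' , i')  ≈⟨ ∑V-split _ ⟩
      ∑ (λ j → A (suc r , i) (zero , j) * A (suc r' , i') (zero , j)) + ∑ {n'} (λ s → ∑ {n} (λ j → 0# * 0#))
        ≈⟨ +-cong (trans (∑-cong (λ j → *-cong (A-s0 r i j) (A-s0 r' i' j))) (∑-δᶜδᶜ-row i i')) (trans (∑-cong (λ _ → ∑-0#*0#)) ∑-0#) ⟩
      ((m + - 1#) + δ i i') + 0#  ≈⟨ +-identityʳ _ ⟩
      (m + - 1#) + δ i i' ∎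

    AᵀA-00 : ∀ i i' → AᵀA (zero , i) (zero , i') ≈ m * ((m + - 1#) + δ i i')
    AᵀA-00 i i' = begin
      AᵀA (zero , i) (zero , i')  ≈⟨ ∑V-split _ ⟩
      ∑ {n} (λ k → 0# * 0#) + ∑ (λ r → ∑ (λ k → A (suc r , k) (zero , i) * A (suc r , k) (zero , i')))
        ≈⟨ +-cong ∑-0#*0# (∑-cong (λ r → trans (∑-cong (λ k → *-cong (A-s0 r k i) (A-s0 r k i'))) (∑-δᶜδᶜ-col i i'))) ⟩
      0# + ∑ {n'} (λ _ → (m + - 1#) + δ i i')  ≈⟨ trans (+-identityˡ _) (∑-const _) ⟩
      m * ((m + - 1#) + δ i i') ∎
    AᵀA-0s : ∀ i s' i' → AᵀA (zero , i) (suc s' , i') ≈ 0#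
    AᵀA-0s i s' i' = begin
      AᵀA (zero , i) (suc s' , i')  ≈⟨ ∑V-split _ ⟩
      ∑ {n} (λ k → 0# * A (zero , k) (suc s' , i')) + ∑ {n'} (λ r → ∑ {n} (λ k → A (suc r , k) (zero , i) * 0#))
        ≈⟨ +-cong (trans (∑-cong (λ j → zeroˡ _)) ∑-0#) (trans (∑-cong (λ r → trans (∑-cong (λ j → zeroʳ _)) ∑-0#)) ∑-0#) ⟩
      0# + 0#  ≈⟨ +-identityʳ _ ⟩
      0# ∎
    AᵀA-s0 : ∀ s i i' → AᵀA (suc s , i) (zero , i') ≈ 0#
    AᵀA-s0 s i i' = begin
      AᵀA (suc s , i) (zero , i')  ≈⟨ ∑V-split _ ⟩
      ∑ {n} (λ k → A (zero , k) (suc s , i) * 0#) + ∑ {n'} (λ r → ∑ {n} (λ k → 0# * A (suc r , k) (zero , i')))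
        ≈⟨ +-cong (trans (∑-cong (λ j → zeroʳ _)) ∑-0#) (trans (∑-cong (λ r → trans (∑-cong (λ j → zeroˡ _)) ∑-0#)) ∑-0#) ⟩
      0# + 0#  ≈⟨ +-identityʳ _ ⟩
      0# ∎
    AᵀA-ss : ∀ s i s' i' → AᵀA (suc s , i) (suc s' , i') ≈ δ i i'
    AᵀA-ss s i s' i' = begin
      AᵀA (suc s , i) (suc s' , i')  ≈⟨ ∑V-split _ ⟩
      ∑ (λ k → A (zero , k) (suc s , i) * A (zero , k) (suc s' , i')) + ∑ {n'} (λ r → ∑ {n} (λ k → 0# * 0#))
        ≈⟨ +-cong (trans (∑-cong (λ k → *-cong (A-0s k s i) (A-0s k s' i'))) (∑-δδ-col i i')) (trans (∑-cong (λ _ → ∑-0#*0#)) ∑-0#) ⟩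
      δ i i' + 0#  ≈⟨ +-identityʳ _ ⟩
      δ i i' ∎

  module LaplacianIdentities {n : ℕ} (L A : Vertex n → Vertex n → Carrier) (d : Carrier)
    (L≈dI-A : ∀ u v → L u v ≈ δV u v * d + - A u v) (A-rowSum≈d : ∀ u → ∑V (A u) ≈ d) where

    L-rowSum≈0 : ∀ u → ∑V (L u) ≈ 0#
    L-rowSum≈0 u = begin
      ∑V (L u)  ≈⟨ ∑V-cong (λ v → trans (L≈dI-A u v) (+-congʳ (*-comm _ _))) ⟩
      ∑V (λ v → d * δV u v + - A u v)  ≈⟨ ∑V-distrib-+ (λ v → d * δV u v) (λ v → - A u v) ⟩
      ∑V (λ v → d * δV u v) + ∑V (λ v → - A u v)  ≈⟨ +-cong (∑V-*δV′ (λ _ → d) u) (trans (sym (-‿distrib-∑V (A u))) (-‿cong (A-rowSum≈d u))) ⟩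
      d + - d  ≈⟨ -‿inverseʳ d ⟩
      0# ∎

    L-colSum : ∀ u → colSum L u ≈ d + - ∑V (λ w → A w u)
    L-colSum u = begin
      ∑V (λ w → L w u)  ≈⟨ ∑V-cong (λ w → trans (L≈dI-A w u) (+-congʳ (*-comm _ _))) ⟩
      ∑V (λ w → d * δV w u + - A w u)  ≈⟨ ∑V-distrib-+ (λ w → d * δV w u) (λ w → - A w u) ⟩
      ∑V (λ w → d * δV w u) + ∑V (λ w → - A w u)  ≈⟨ +-cong (∑V-*δV (λ _ → d) u) (sym (-‿distrib-∑V (λ w → A w u))) ⟩
      d + - ∑V (λ w → A w u) ∎

    ∑V-product-expand : ∀ (a b p q : Vertex n → Carrier) →
      ∑V (λ v → (a v * d + - p v) * (b v * d + - q v))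
        ≈ (∑V (λ v → (b v * (d * d)) * a v) + - ∑V (λ v → (d * q v) * a v))
          + (- ∑V (λ v → (d * p v) * b v) + ∑V (λ v → p v * q v))
    ∑V-product-expand a b p q = begin
      ∑V (λ v → (a v * d + - p v) * (b v * d + - q v))
        ≈⟨ ∑V-cong (λ v → solve 5 (λ a b p q d → (((a :* d) :+ (:- p)) :* ((b :* d) :+ (:- q)))
                := ((((b :* (d :* d)) :* a) :+ (:- ((d :* q) :* a))) :+ ((:- ((d :* p) :* b)) :+ (p :* q)))) refl (a v) (b v) (p v) (q v) d) ⟩
      ∑V (λ v → (((b v * (d * d)) * a v) + - ((d * q v) * a v)) + ((- ((d * p v) * b v)) + p v * q v))
        ≈⟨ trans (∑V-distrib-+ _ _) (+-cong (trans (∑V-distrib-+ _ _) (+-congˡ (sym (-‿distrib-∑V _))))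
                                   (trans (∑V-distrib-+ _ _) (+-congʳ (sym (-‿distrib-∑V _))))) ⟩
      (∑V (λ v → (b v * (d * d)) * a v) + - ∑V (λ v → (d * q v) * a v))
          + (- ∑V (λ v → (d * p v) * b v) + ∑V (λ v → p v * q v)) ∎

    rowGram-colGram : ∀ u u' → rowGram L u u' + - colGram L u u' ≈ ∑V (λ w → A u w * A u' w) + - ∑V (λ w → A w u * A w u')
    rowGram-colGram u u' = begin
      rowGram L u u' + - colGram L u u'
        ≈⟨ +-cong (trans (∑V-cong (λ v → *-cong (L≈dI-A u v) (L≈dI-A u' v))) (∑V-product-expand (δV u) (δV u') (A u) (A u')))
                  (-‿cong (trans (∑V-cong (λ w → *-cong (L≈dI-A w u) (L≈dI-A w u'))) (∑V-product-expand (λ w → δV w u) (λ w → δV w u') (λ w → A w u) (λ w → A w u')))) ⟩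
      ((∑V (λ v → (δV u' v * (d * d)) * δV u v) + - ∑V (λ v → (d * A u' v) * δV u v))
          + (- ∑V (λ v → (d * A u v) * δV u' v) + ∑V (λ v → A u v * A u' v)))
      + - ((∑V (λ w → (δV w u' * (d * d)) * δV w u) + - ∑V (λ w → (d * A w u') * δV w u))
          + (- ∑V (λ w → (d * A w u) * δV w u') + ∑V (λ w → A w u * A w u')))
        ≈⟨ +-cong (+-cong (+-cong (∑V-*δV′ (λ v → δV u' v * (d * d)) u) (-‿cong (∑V-*δV′ (λ v → d * A u' v) u)))
                          (+-congʳ (-‿cong (∑V-*δV′ (λ v → d * A u v) u'))))
                  (-‿cong (+-cong (+-cong (∑V-*δV (λ w → δV w u' * (d * d)) u) (-‿cong (∑V-*δV (λ w → d * A w u') u)))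
                          (+-congʳ (-‿cong (∑V-*δV (λ w → d * A w u) u'))))) ⟩
      ((δV u' u * (d * d) + - (d * A u' u)) + (- (d * A u u') + P1))
        + - ((δV u u' * (d * d) + - (d * A u u')) + (- (d * A u' u) + P2))
        ≈⟨ +-congʳ (+-congʳ (+-congʳ (*-congʳ (δV-sym u' u)))) ⟩
      ((δV u u' * (d * d) + - (d * A u' u)) + (- (d * A u u') + P1))
        + - ((δV u u' * (d * d) + - (d * A u u')) + (- (d * A u' u) + P2))
        ≈⟨ solve 5 (λ e a b p1 p2 → ((((e :+ (:- a)) :+ ((:- b) :+ p1))) :+ (:- ((e :+ (:- b)) :+ ((:- a) :+ p2)))) := (p1 :+ (:- p2)))
              refl (δV u u' * (d * d)) (d * A u' u) (d * A u u') P1 P2 ⟩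
      P1 + - P2 ∎
      where
      P1 P2 : Carrier
      P1 = ∑V (λ v → A u v * A u' v)
      P2 = ∑V (λ w → A w u * A w u')

  c₀ᴾ c₁ᴾ : ∀ {k} → Polynomial k → Polynomial k
  c₀ᴾ m = m :+ (:- (m :* m))
  c₁ᴾ m = m :+ (:- con (+ 1))
  αᴾ βᴾ : ∀ {k} → Polynomial k → Polynomial k → Polynomial k
  αᴾ m x = (:- (m :* c₁ᴾ m)) :+ (x :* (c₀ᴾ m :* c₀ᴾ m))
  βᴾ m x = x :* (c₀ᴾ m :* c₁ᴾ m)

  fromℤ-if : ∀ b a → fromℤ (if b then + a else + 0) ≈ (if b then 1# else 0#) * fromℕ a
  fromℤ-if true a = sym (*-identityˡ _)
  fromℤ-if false a = sym (zeroˡ _)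

  if-eqV≈δV : ∀ {n} (u v : Vertex n) → (if eqV u v then 1# else 0#) ≈ δV u v
  if-eqV≈δV (r , i) (s , j) with r ≟ s | i ≟ j
  ... | yes ≡.refl | yes ≡.refl = sym (trans (*-cong (δ-refl r) (δ-refl i)) (*-identityˡ _))
  ... | yes ≡.refl | no ne = sym (trans (*-congˡ (δ-≢ i j ne)) (zeroʳ _))
  ... | no ne | _ = sym (trans (*-congʳ (δ-≢ r s ne)) (zeroˡ _))

  module Laplacian (n' : ℕ) where
    open Adjacency n'

    L : Vertex n → Vertex n → Carrier
    L u v = ℤ→K K (laplacian (adjΓ n) u v)

    fromℕ-outdeg : ∀ u → fromℕ (outdeg (adjΓ n) u) ≈ m
    fromℕ-outdeg u = trans (fromℕ-sumℕ (λ s → sumℕ (λ j → b2n (adjΓ n u (s , j)))))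
              (trans (∑-cong (λ s → fromℕ-sumℕ (λ j → b2n (adjΓ n u (s , j))))) (trans (sym (reflexive (∑V-def (A u)))) (A-rowSum u)))

    L≈mI-A : ∀ u v → L u v ≈ δV u v * m + - A u v
    L≈mI-A u v = begin
      ℤ→K K (laplacian (adjΓ n) u v)  ≈⟨ ℤ→K≈fromℤ (laplacian (adjΓ n) u v) ⟩
      fromℤ (I ℤ.+ ℤ.- J)
        ≈⟨ trans (fromℤ-+ I (ℤ.- J)) (+-congˡ (fromℤ-neg J)) ⟩
      fromℤ (if eqV u v then + outdeg (adjΓ n) u else + 0) + - A u v
        ≈⟨ +-congʳ (trans (fromℤ-if (eqV u v) _) (*-cong (if-eqV≈δV u v) (fromℕ-outdeg u))) ⟩
      δV u v * m + - A u v ∎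
      where
      I J : ℤ
      I = if eqV u v then + outdeg (adjΓ n) u else + 0
      J = + b2n (adjΓ n u v)

    open LaplacianIdentities L A m L≈mI-A A-rowSum

    c₀ c₁ : Carrier
    c₀ = m + - (m * m)
    c₁ = m + - 1#

    colSum-L : Vertex n → Carrier
    colSum-L (zero , _) = c₀
    colSum-L (suc _ , _) = c₁

    colSum≈colSum-L : ∀ u → colSum L u ≈ colSum-L u
    colSum≈colSum-L (zero , j) = trans (L-colSum (zero , j)) (+-congˡ (-‿cong (A-colSum (zero , j))))
    colSum≈colSum-L (suc s , j) = trans (L-colSum (suc s , j)) (+-congˡ (-‿cong (A-colSum (suc s , j))))

    -- An entry of L Lᵀ + x c cᵀ - Lᵀ L depends only on which blocks its indices lie in, up to a
    -- δ i i' that cancels; the resulting 2 × 2 block pattern is separable because n² x = 1.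
    module _ (x : Carrier) (hx : (1# + m) * (1# + m) * x ≈ 1#) where
      α β : Carrier
      α = - (m * (m + - 1#)) + x * (c₀ * c₀)
      β = x * (c₀ * c₁)

      g h : Vertex n → Carrier
      g (zero , _) = 0#
      g (suc _ , _) = β + - α
      h (zero , _) = α
      h (suc _ , _) = β

      separable-entries : ∀ u u' → ∑V (λ w → A u w * A u' w) + - ∑V (λ w → A w u * A w u') + x * (colSum-L u * colSum-L u') ≈ g u + h u'
      separable-entries (zero , i) (zero , i') = trans (+-congʳ (+-cong (AAᵀ-00 i i') (-‿cong (AᵀA-00 i i'))))
        (solve 3 (λ m d x → (((m :* d) :+ (:- (m :* (c₁ᴾ m :+ d)))) :+ (x :* (c₀ᴾ m :* c₀ᴾ m)))
                  := (con (+ 0) :+ αᴾ m x)) refl m (δ i i') x)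
      separable-entries (zero , i) (suc r' , i') = trans (+-congʳ (+-cong (AAᵀ-0s i r' i') (-‿cong (AᵀA-0s i r' i'))))
        (solve 2 (λ m x → ((con (+ 0) :+ (:- con (+ 0))) :+ (x :* (c₀ᴾ m :* c₁ᴾ m)))
                  := (con (+ 0) :+ βᴾ m x)) refl m x)
      separable-entries (suc r , i) (zero , i') = trans (+-congʳ (+-cong (AAᵀ-s0 r i i') (-‿cong (AᵀA-s0 r i i'))))
        (solve 2 (λ m x → ((con (+ 0) :+ (:- con (+ 0))) :+ (x :* (c₁ᴾ m :* c₀ᴾ m)))
                  := ((βᴾ m x :+ (:- αᴾ m x)) :+ αᴾ m x)) refl m x)
      separable-entries (suc r , i) (suc r' , i') = begin
        ((AAᵀ (suc r , i) (suc r' , i') + - AᵀA (suc r , i) (suc r' , i')) + x * (c₁ * c₁))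
          ≈⟨ +-congʳ (+-cong (AAᵀ-ss r i r' i') (-‿cong (AᵀA-ss r i r' i'))) ⟩
        (((m + - 1#) + δ i i') + - δ i i') + x * (c₁ * c₁)
          ≈⟨ solve 3 (λ m d x → (((c₁ᴾ m :+ d) :+ (:- d)) :+ (x :* (c₁ᴾ m :* c₁ᴾ m)))
                := (((βᴾ m x :+ (:- αᴾ m x)) :+ βᴾ m x)
                   :+ ((c₁ᴾ m :* c₁ᴾ m) :* ((((con (+ 1) :+ m) :* (con (+ 1) :+ m)) :* x) :+ (:- con (+ 1)))))) refl m (δ i i') x ⟩
        ((β + - α) + β) + (c₁ * c₁) * ((1# + m) * (1# + m) * x + - 1#)
          ≈⟨ +-congˡ (trans (*-congˡ (trans (+-congʳ hx) (-‿inverseʳ 1#))) (zeroʳ _)) ⟩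
        ((β + - α) + β) + 0#  ≈⟨ +-identityʳ _ ⟩
        (β + - α) + β ∎

      separable : ∀ u u' → (rowGram L u u' + x * (colSum L u * colSum L u')) + - colGram L u u' ≈ g u + h u'
      separable u u' = begin
        (rowGram L u u' + x * (colSum L u * colSum L u')) + - colGram L u u'
          ≈⟨ solve 3 (λ a b c → ((a :+ c) :+ (:- b)) := ((a :+ (:- b)) :+ c)) refl (rowGram L u u') (colGram L u u') _ ⟩
        (rowGram L u u' + - colGram L u u') + x * (colSum L u * colSum L u')
          ≈⟨ +-cong (rowGram-colGram u u') (*-congˡ (*-cong (colSum≈colSum-L u) (colSum≈colSum-L u'))) ⟩
        ∑V (λ w → A u w * A u' w) + - ∑V (λ w → A w u * A w u') + x * (colSum-L u * colSum-L u')
          ≈⟨ separable-entries u u' ⟩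
        g u + h u' ∎

    restricted-normal : Σ Carrier (λ x → ℕ→K K (n ℕ.* n) * x ≈ 1#) →
      (Q : Vertex n → Fin (n ℕ.* n ℕ.∸ 1) → Carrier) → IsRestrictor K n Q →
      IsNormalK K (restrictL K n Q (laplacian (adjΓ n)))
    restricted-normal = restriction-normal n' (laplacian (adjΓ n)) L-rowSum≈0
      (λ x N*x≈1 → let hx = n²*x≈1 x N*x≈1 in g x hx , h x hx , separable x hx)
      where
      n²*x≈1 : ∀ x → ℕ→K K (n ℕ.* n) * x ≈ 1# → (1# + m) * (1# + m) * x ≈ 1#
      n²*x≈1 x = trans (*-congʳ (sym (trans (ℕ→K≈fromℕ (n ℕ.* n)) (trans (fromℕ-* n n) (*-cong (fromℕ-suc n') (fromℕ-suc n'))))))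

  module NonNormality (n₁ : ℕ) where
    open Adjacency (suc n₁)
    open Laplacian (suc n₁)
    open LaplacianIdentities L A m L≈mI-A A-rowSum

    -- At ((0 , 0) , (0 , 1)) the entries of L Lᵀ and Lᵀ L are 0 and m (m - 1).
    normal⇒m[m-1]≈0 : rowGram L (zero , zero) (zero , suc zero) ≈ colGram L (zero , zero) (zero , suc zero) → m * (m + - 1#) ≈ 0#
    normal⇒m[m-1]≈0 e = begin
      m * (m + - 1#)  ≈⟨ sym (-‿involutive _) ⟩
      - (- (m * (m + - 1#)))  ≈⟨ -‿cong (solve 1 (λ m → (:- (m :* (m :+ (:- con (+ 1))))) := ((m :* con (+ 0)) :+ (:- (m :* ((m :+ (:- con (+ 1))) :+ con (+ 0)))))) refl m) ⟩
      - (m * 0# + - (m * ((m + - 1#) + 0#)))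
        ≈⟨ -‿cong (sym (+-cong (AAᵀ-00 zero (suc zero)) (-‿cong (AᵀA-00 zero (suc zero))))) ⟩
      - (∑V (λ w → A (zero , zero) w * A (zero , suc zero) w) + - ∑V (λ w → A w (zero , zero) * A w (zero , suc zero)))
        ≈⟨ -‿cong (sym (rowGram-colGram (zero , zero) (zero , suc zero))) ⟩
      - (rowGram L (zero , zero) (zero , suc zero) + - colGram L (zero , zero) (zero , suc zero))
        ≈⟨ -‿cong (trans (+-congʳ e) (-‿inverseʳ _)) ⟩
      - 0#  ≈⟨ -0#≈0# ⟩
      0# ∎

ℤ-involutive : InvolutiveCommRing
ℤ-involutive = record
  { commRing   = ℤ.+-*-commutativeRing
  ; conj       = λ z → z
  ; conj-cong  = λ e → e
  ; conj-+     = λ _ _ → ≡.refl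
  ; conj-*     = λ _ _ → ≡.refl
  ; conj-1     = ≡.refl
  ; conj-invol = λ _ → ≡.refl
  }

sumK-ℤ : ∀ {k} (f : Fin k → ℤ) → sumK ℤ-involutive f ≡ sumℤ f
sumK-ℤ {zero}  f = ≡.refl
sumK-ℤ {suc k} f = ≡.cong (λ z → f zero ℤ.+ z) (sumK-ℤ (λ i → f (suc i)))

ℕ→K-ℤ : ∀ m → ℕ→K ℤ-involutive m ≡ + m
ℕ→K-ℤ zero    = ≡.refl
ℕ→K-ℤ (suc m) = ≡.cong (λ z → + 1 ℤ.+ z) (ℕ→K-ℤ m)

ℤ→K-ℤ : ∀ z → ℤ→K ℤ-involutive z ≡ z
ℤ→K-ℤ (+ m)    = ℕ→K-ℤ m
ℤ→K-ℤ -[1+ m ] = ≡.cong ℤ.-_ (ℕ→K-ℤ (suc m))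

sumℤ-cong : ∀ {k} {g h : Fin k → ℤ} → (∀ r → g r ≡ h r) → sumℤ g ≡ sumℤ h
sumℤ-cong {zero}  e = ≡.refl
sumℤ-cong {suc k} e = ≡.cong₂ ℤ._+_ (e zero) (sumℤ-cong (λ r → e (suc r)))

module IntegerLaplacian (n₂ : ℕ) where
  open Restriction ℤ-involutive using (∑V; sumVK≈∑V; rowGram; colGram; ℕ→K≈fromℕ)
  open DigraphΓ ℤ-involutive
  open Adjacency (suc (suc n₂))
  open Laplacian (suc (suc n₂))
  open NonNormality (suc n₂)

  ∑V≡sumVℤ : ∀ (f : Vertex n → ℤ) → ∑V f ≡ sumVℤ f
  ∑V≡sumVℤ f = ≡.trans (≡.sym (sumVK≈∑V f))
    (≡.trans (sumK-ℤ (λ r → sumK ℤ-involutive (λ i → f (r , i)))) (sumℤ-cong (λ r → sumK-ℤ (λ i → f (r , i)))))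

  normal⇒rowGram≡colGram : ∀ u v → IsNormalℤ (laplacian (adjΓ n)) → rowGram L u v ≡ colGram L u v
  normal⇒rowGram≡colGram u v normal = begin
    rowGram L u v                                         ≡⟨ ∑V≡sumVℤ _ ⟩
    sumVℤ (λ w → L u w ℤ.* L v w)
      ≡⟨ sumℤ-cong (λ r → sumℤ-cong (λ i → ≡.cong₂ ℤ._*_ (ℤ→K-ℤ (Lℤ u (r , i))) (ℤ→K-ℤ (Lℤ v (r , i))))) ⟩
    sumVℤ (λ w → Lℤ u w ℤ.* Lℤ v w)                       ≡⟨ normal u v ⟩
    sumVℤ (λ w → Lℤ w u ℤ.* Lℤ w v)
      ≡⟨ sumℤ-cong (λ r → sumℤ-cong (λ i → ≡.cong₂ ℤ._*_ (ℤ→K-ℤ (Lℤ (r , i) u)) (ℤ→K-ℤ (Lℤ (r , i) v)))) ⟨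
    sumVℤ (λ w → L w u ℤ.* L w v)                         ≡⟨ ∑V≡sumVℤ _ ⟨
    colGram L u v                                         ∎
    where
    open ≡.≡-Reasoning
    Lℤ : Vertex n → Vertex n → ℤ
    Lℤ = laplacian (adjΓ n)

  laplacian-not-normal : ¬ IsNormalℤ (laplacian (adjΓ n))
  laplacian-not-normal normal = [n-1][n-2]≢0 (≡.subst (λ k → k ℤ.* (k ℤ.+ ℤ.- + 1) ≡ + 0) m≡n-1
    (normal⇒m[m-1]≈0 (normal⇒rowGram≡colGram (zero , zero) (zero , suc zero) normal)))
    where
    m≡n-1 : m ≡ + suc (suc n₂)
    m≡n-1 = ≡.trans (≡.sym (ℕ→K≈fromℕ (suc (suc n₂)))) (ℕ→K-ℤ (suc (suc n₂)))
    -- This is where n ≥ 3 is needed.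
    [n-1][n-2]≢0 : + suc (suc n₂) ℤ.* (+ suc (suc n₂) ℤ.+ ℤ.- + 1) ≢ + 0
    [n-1][n-2]≢0 ()

Γ-laplacian-not-normal : ∀ n₂ → ¬ IsNormalℤ (laplacian (adjΓ (3 ℕ.+ n₂)))
Γ-laplacian-not-normal = IntegerLaplacian.laplacian-not-normal

Γ-restricted-laplacian-normal : ∀ n' (K : InvolutiveCommRing) → let open InvolutiveCommRing K in
  Σ Carrier (λ x → ℕ→K K (suc n' ℕ.* suc n') * x ≈ 1#) →
  (Q : Vertex (suc n') → Fin (suc n' ℕ.* suc n' ℕ.∸ 1) → Carrier) → IsRestrictor K (suc n') Q →
  IsNormalK K (restrictL K (suc n') Q (laplacian (adjΓ (suc n'))))
Γ-restricted-laplacian-normal n' K = DigraphΓ.Laplacian.restricted-normal K n'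

eqFin≡true⇒≡ : ∀ {k} (i j : Fin k) → eqFin i j ≡ true → i ≡ j
eqFin≡true⇒≡ i j e with i ≟ j
... | yes i≡j = i≡j
eqFin≡true⇒≡ i j () | no _

eqFin-refl : ∀ {k} (i : Fin k) → eqFin i i ≡ true
eqFin-refl i with i ≟ i
... | yes _ = ≡.refl
... | no i≢i = ⊥-elim (i≢i ≡.refl)

other : ∀ {k} → Fin (suc (suc k)) → Fin (suc (suc k))
other zero    = suc zero
other (suc _) = zero

other-≢ : ∀ {k} (i : Fin (suc (suc k))) → other i ≢ i
other-≢ zero    ()
other-≢ (suc i) ()

-- Some edge goes from V₁ to V₂. If it lies in a block I (from block 1 to block s), the
-- vertex (1 , other i) must be in V₂, yet (1 , i) → (1 , other i) is not an edge. If it lies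
-- in a block J - I (from block r to block 1), then (r , j) must be in V₂, yet (r , i) → (r , j)
-- is not an edge.
Γ-not-directed-join : ∀ k → ¬ IsDirectedJoin (suc (suc k)) (adjΓ (suc (suc k)))
Γ-not-directed-join k (S , ((r , i) , Sv) , ((s , j) , Sw) , V₁→V₂ , _) = go r s (V₁→V₂ (r , i) (s , j) Sv Sw) Sv Sw
  where
  go : ∀ r s → adjΓ (suc (suc k)) (r , i) (s , j) ≡ true → S (r , i) ≡ true → S (s , j) ≡ false → ⊥
  go zero     zero     () _ _
  go zero     (suc s') e Sv Sw with S (zero , other i) in h
  ... | true  = other-≢ i (≡.trans (eqFin≡true⇒≡ (other i) j (V₁→V₂ (zero , other i) (suc s' , j) h Sw))
                                   (≡.sym (eqFin≡true⇒≡ i j e)))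
  ... | false with () ← V₁→V₂ (zero , i) (zero , other i) Sv h
  go (suc r') zero     e Sv Sw with S (suc r' , j) in h
  ... | true  with V₁→V₂ (suc r' , j) (zero , j) h Sw
  ...   | p rewrite eqFin-refl j with () ← p
  go (suc r') zero     e Sv Sw | false with () ← V₁→V₂ (suc r' , i) (suc r' , j) Sv h
  go (suc r') (suc s') () _ _

theorem3p12 : (n : ℕ) → 3 ≤ n →
    IsRestrictedNormal n (adjΓ n) × ¬ IsDirectedJoin n (adjΓ n)
theorem3p12 (suc (suc (suc n₂))) (s≤s (s≤s (s≤s z≤n))) =
  (Γ-laplacian-not-normal n₂ , Γ-restricted-laplacian-normal (suc (suc n₂))) , Γ-not-directed-join (suc n₂)
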